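{- Let $\lambda$ be a partition with $\lambda_i\ge i$ for all $i$ and GJW sequence $(g_1,\dots,g_n)$, and let $i$ be a row with $g_i\ne 0$. Then $X_{\{c_i\}}$ is a chain, whose length is $1$ if $c_i$ is obtained from $\hat{1}$ by a switch move, and is $g_i$ if $c_i$ is obtained from $\hat{1}$ by a push move.
   Context: Ferrers board of $\lambda=(\lambda_1\le\cdots\le\lambda_n)$: cells $(i,j)$, row $i$ from the bottom, $1\le j\le\lambda_i$; $g_i=\lambda_i-i$. Maximal rook placements: sequences $x=(x_1,\dots,x_n)$ of distinct integers with $1\le x_i\le\lambda_i$; rook poset $P_\lambda$: $x\le y$ iff for all $m$ the sorted list of $\{x_1,\dots,x_m\}$ is entrywise $\le$ that of $\{y_1,\dots,y_m\}$. Maximum $\hat{1}$: $\hat{1}_i=\max(\{1,\dots,\lambda_i\}\setminus\{\hat{1}_1,\dots,\hat{1}_{i-1}\})$. Switch move on rook $i$: if rooks occupy $(i,j)$ and $(k,l)$ with $i<k$, $j>l$, and the rectangle with these corners contains no other rooks, replace them by $(i,l)$ and $(k,j)$. Push move on rook $i$: if a rook occupies $(i,j)$, column $k<j$ is empty, and every column $r$ with $k<r<j$ has a rook below row $i$, replace $(i,j)$ by $(i,k)$. For each $i$ with $g_i\ne0$ exactly one placement is obtained from $\hat{1}$ by a single switch or push move on rook $i$; it is the coatom $c_i$, and these are all the coatoms (elements covered by $\hat{1}$). For a set $I$ of coatoms, $X_I=\{y\in P_\lambda: y\not\le c \text{ for every coatom } c\notin I\}$ (note $\hat{1}\in X_I$).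 The length of a finite chain is its number of elements minus one. -}

module Defs where

open import Data.Nat using (ℕ; zero; suc; _+_; _∸_; _≤_; _<_; _≡ᵇ_)
open import Data.Nat.Properties using (≤-decTotalOrder)
open import Data.Bool using (Bool; true; false; if_then_else_; _∨_)
open import Data.Fin using (Fin; toℕ) renaming (_≤_ to _≤ᶠ_; _<_ to _<ᶠ_)
open import Data.Vec using (Vec; []; _∷_; lookup; toList; _[_]≔_)
open import Data.List using (List; []; _∷_; take; length)
open import Data.Bool.ListAction using (any)
open import Data.List.Sort ≤-decTotalOrder using (sort)
open import Data.List.Relation.Binary.Pointwise using (Pointwise)
open import Data.List.Relation.Unary.Unique.Propositional using (Unique)
open import Data.List.Membership.Propositional using (_∈_)
open import Data.Product using (Σ; ∃; _×_; _,_)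
open import Data.Sum using (_⊎_)
open import Relation.Binary.PropositionalEquality using (_≡_; _≢_)
open import Relation.Nullary using (¬_)

-- Rows are indexed by Fin n; row r : Fin n is row number (toℕ r + 1).
-- A shape λ = (λ₁ ≤ ... ≤ λₙ) is a Vec ℕ n.

IsPartition : ∀ {n} → Vec ℕ n → Set
IsPartition {n} lam = ∀ (r s : Fin n) → r ≤ᶠ s → lookup lam r ≤ lookup lam s

RowBound : ∀ {n} → Vec ℕ n → Set
RowBound {n} lam = ∀ (r : Fin n) → suc (toℕ r) ≤ lookup lam r

-- GJW sequence g_i = λ_i - i  (non-negative under RowBound)
gjw : ∀ {n} → Vec ℕ n → Fin n → ℕ
gjw lam r = lookup lam r ∸ suc (toℕ r)

IsPlacement : ∀ {n} → Vec ℕ n → Vec ℕ n → Set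
IsPlacement {n} lam x =
  (∀ (r : Fin n) → 1 ≤ lookup x r × lookup x r ≤ lookup lam r)
  × (∀ (r s : Fin n) → lookup x r ≡ lookup x s → r ≡ s)

_≼_ : ∀ {n} → Vec ℕ n → Vec ℕ n → Set
x ≼ y = ∀ (m : ℕ) → Pointwise _≤_ (sort (take m (toList x))) (sort (take m (toList y)))

-- the maximum 1̂: 1̂_i = max({1..λ_i} \ {1̂_1..1̂_{i-1}})
elemB : ℕ → List ℕ → Bool
elemB k xs = any (λ y → k ≡ᵇ y) xs

maxAvail : ℕ → List ℕ → ℕ
maxAvail zero used = zero
maxAvail (suc k) used = if elemB (suc k) used then maxAvail k used else suc k

topFrom : ∀ {n} → Vec ℕ n → List ℕ → Vec ℕ n
topFrom [] used = []
topFrom (l ∷ ls) used = maxAvail l used ∷ topFrom ls (maxAvail l used ∷ used)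

top : ∀ {n} → Vec ℕ n → Vec ℕ n
top lam = topFrom lam []

SwitchMove : ∀ {n} → Vec ℕ n → Fin n → Vec ℕ n → Set
SwitchMove {n} x i y = Σ (Fin n) λ k →
  i <ᶠ k × lookup x k < lookup x i
  × (∀ (r : Fin n) → r ≢ i → r ≢ k → i ≤ᶠ r → r ≤ᶠ k →
       ¬ (lookup x k ≤ lookup x r × lookup x r ≤ lookup x i))
  × y ≡ (x [ i ]≔ lookup x k) [ k ]≔ lookup x i

PushMove : ∀ {n} → Vec ℕ n → Fin n → Vec ℕ n → Set
PushMove {n} x i y = Σ ℕ λ c →
  1 ≤ c × c < lookup x i
  × (∀ (r : Fin n) → lookup x r ≢ c)
  × (∀ (q : ℕ) → c < q → q < lookup x i → Σ (Fin n) λ r → r <ᶠ i × lookup x r ≡ q)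
  × y ≡ x [ i ]≔ c

Coatom : ∀ {n} → Vec ℕ n → Vec ℕ n → Set
Coatom lam c =
  IsPlacement lam c × c ≢ top lam × c ≼ top lam
  × (∀ z → IsPlacement lam z → c ≼ z → z ≼ top lam → z ≡ c ⊎ z ≡ top lam)

InX : ∀ {n} → Vec ℕ n → Vec ℕ n → Vec ℕ n → Set
InX lam c y = IsPlacement lam y × (∀ c' → Coatom lam c' → c' ≢ c → ¬ (y ≼ c'))

IsChainOfLength : ∀ {n} → (Vec ℕ n → Set) → ℕ → Set
IsChainOfLength {n} P L =
  (∀ y z → P y → P z → y ≼ z ⊎ z ≼ y)
  × Σ (List (Vec ℕ n)) λ ys → Unique ys × length ys ≡ suc L
      × (∀ y → (y ∈ ys → P y) × (P y → y ∈ ys))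

{-# OPTIONS --safe #-}
-- Compare placements through rows≥ y M s, the number of values ≥ s among the first M rows of y: x ≼ y
-- exactly when every such count of x is at most that of y. The maximum 1̂ is the greedy placement t, in
-- which every value between t r and λ_r is taken below row r. A switch or push of rook m of t changes
-- these counts only inside a window of prefixes and thresholds, so anything squeezed between the moved
-- placement and t is one of the two: these are the coatoms. Every placement z ≠ t lies below the coatom
-- at the row where z first differs from t. Hence, for y ∈ X_{c_i}, every placement above y other than t
-- first differs from t at row i, and raising row i of y back to t_i shows that y is t with row i lowered,
-- or t with rows i < r exchanged. For a switch only c_i and 1̂ survive; for a push, y is t with row i
-- lowered to any value v ≤ λ_i not taken below row i, a chain ordered by v with λ_i − i + 1 = g_i + 1 elements.
module Submission where

open import Defs
open import Data.Nat
open import Data.Nat.Properties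
open import Data.Nat.ListAction using (sum)
open import Data.Nat.ListAction.Properties using (sum-↭)
open import Data.List using (List; []; _∷_; take; length; map; filter; downFrom)
open import Data.List.Relation.Binary.Pointwise using (Pointwise; []; _∷_)
open import Data.List.Relation.Unary.AllPairs using (AllPairs; []; _∷_)
open import Data.List.Relation.Unary.All using (All; []; _∷_) renaming (map to All-map)
open import Data.List.Relation.Binary.Permutation.Propositional.Properties using (↭-length; map⁺)
open import Data.List.Sort ≤-decTotalOrder using (sort; sort-↭; sort-↗)
open import Data.List.Relation.Unary.Sorted.TotalOrder.Properties using (Sorted⇒AllPairs)
open import Data.List.Properties using (length-map)
open import Data.List.Membership.Propositional using (_∈_)
open import Data.List.Membership.Propositional.Properties using (∈-map⁺; ∈-map⁻; ∈-filter⁺; ∈-filter⁻; ∈-downFrom⁺; ∈-downFrom⁻)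
open import Data.List.Relation.Unary.Any using (here; there)
open import Data.List.Relation.Unary.Unique.Propositional using (Unique)
import Data.List.Relation.Unary.Unique.Propositional.Properties as Unique
open import Data.Vec using (Vec; []; _∷_; lookup; toList; _[_]≔_)
import Data.Vec.Properties
open import Data.Fin using (Fin; toℕ; fromℕ<) renaming (zero to fzero; suc to fsuc)
open import Data.Fin.Properties using (toℕ-fromℕ<; toℕ-injective; toℕ<n)
open import Data.Product using (∃; _×_; _,_; proj₁; proj₂)
open import Data.Sum using (_⊎_; inj₁; inj₂; [_,_]′)
open import Relation.Binary.Definitions using (tri<; tri≈; tri>)
open import Relation.Nullary using (¬_; Dec; yes; no; contradiction)
open import Relation.Nullary.Decidable using (_×-dec_; ¬?; decidable-stable)
open import Relation.Unary using (Pred; Decidable)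
open import Data.Bool using (true; false; T)
open import Data.Unit using (tt)
open import Level using (0ℓ)
open import Algebra.Properties.CommutativeSemigroup +-commutativeSemigroup using (xy∙z≈xz∙y)
open import Relation.Binary.PropositionalEquality
open import Function using (_∘′_; id; case_of_)

-- Counting values above a threshold

⟦_≤_⟧ : ℕ → ℕ → ℕ
⟦ zero ≤ x ⟧ = 1
⟦ suc s ≤ zero ⟧ = 0
⟦ suc s ≤ suc x ⟧ = ⟦ s ≤ x ⟧

≤⇒⟦≤⟧≡1 : ∀ {s x} → s ≤ x → ⟦ s ≤ x ⟧ ≡ 1
≤⇒⟦≤⟧≡1 z≤n = refl
≤⇒⟦≤⟧≡1 (s≤s s≤x) = ≤⇒⟦≤⟧≡1 s≤x

>⇒⟦≤⟧≡0 : ∀ {s x} → x < s → ⟦ s ≤ x ⟧ ≡ 0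
>⇒⟦≤⟧≡0 {suc s} {zero} _ = refl
>⇒⟦≤⟧≡0 {suc s} {suc x} (s≤s x<s) = >⇒⟦≤⟧≡0 x<s

1≤⟦≤⟧⇒≤ : ∀ {s x} → 1 ≤ ⟦ s ≤ x ⟧ → s ≤ x
1≤⟦≤⟧⇒≤ {zero} _ = z≤n
1≤⟦≤⟧⇒≤ {suc s} {suc x} 1≤⟦s≤x⟧ = s≤s (1≤⟦≤⟧⇒≤ 1≤⟦s≤x⟧)

⟦≤⟧≤1 : ∀ s x → ⟦ s ≤ x ⟧ ≤ 1
⟦≤⟧≤1 zero x = ≤-refl
⟦≤⟧≤1 (suc s) zero = z≤n
⟦≤⟧≤1 (suc s) (suc x) = ⟦≤⟧≤1 s x

⟦≤⟧-mono : ∀ s {x y} → x ≤ y → ⟦ s ≤ x ⟧ ≤ ⟦ s ≤ y ⟧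
⟦≤⟧-mono zero _ = ≤-refl
⟦≤⟧-mono (suc s) {zero} _ = z≤n
⟦≤⟧-mono (suc s) {suc x} (s≤s x≤y) = ⟦≤⟧-mono s x≤y

⟦≤⟧≡0⇒> : ∀ {s x} → ⟦ s ≤ x ⟧ ≡ 0 → x < s
⟦≤⟧≡0⇒> {suc s} {zero} _ = s≤s z≤n
⟦≤⟧≡0⇒> {suc s} {suc x} eq = s≤s (⟦≤⟧≡0⇒> eq)

⟦≤⟧-≡⇒≤ : ∀ {b x y} → ⟦ suc b ≤ x ⟧ ≡ ⟦ suc b ≤ y ⟧ → y ≤ b → x ≤ b
⟦≤⟧-≡⇒≤ eq y≤b = ≤-pred (⟦≤⟧≡0⇒> (trans eq (>⇒⟦≤⟧≡0 (s≤s y≤b))))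

⟦≤⟧-≡⇒≥ : ∀ {a x y} → ⟦ a ≤ x ⟧ ≡ ⟦ a ≤ y ⟧ → a ≤ y → a ≤ x
⟦≤⟧-≡⇒≥ eq a≤y = 1≤⟦≤⟧⇒≤ (≤-reflexive (sym (trans eq (≤⇒⟦≤⟧≡1 a≤y))))

⟦≤⟧-≡⇒≡ : ∀ {x y} → ⟦ y ≤ x ⟧ ≡ ⟦ y ≤ y ⟧ → ⟦ suc y ≤ x ⟧ ≡ ⟦ suc y ≤ y ⟧ → x ≡ y
⟦≤⟧-≡⇒≡ eq eq′ = ≤-antisym (⟦≤⟧-≡⇒≤ eq′ ≤-refl) (⟦≤⟧-≡⇒≥ eq ≤-refl)

≤∧≤∧¬<<⇒≡∨≡ : ∀ {a b x} → a ≤ x → x ≤ b → ¬ (a < x × x < b) → x ≡ a ⊎ x ≡ b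
≤∧≤∧¬<<⇒≡∨≡ {a} {b} {x} a≤x x≤b ¬between with a ≟ x | x ≟ b
... | yes a≡x | _ = inj₁ (sym a≡x)
... | no _ | yes x≡b = inj₂ x≡b
... | no a≢x | no x≢b = contradiction (≤∧≢⇒< a≤x a≢x , ≤∧≢⇒< x≤b x≢b) ¬between

⟦≤⟧-outside : ∀ {s x y} → x ≤ y → s ≤ x ⊎ y < s → ⟦ s ≤ x ⟧ ≡ ⟦ s ≤ y ⟧
⟦≤⟧-outside x≤y (inj₁ s≤x) = trans (≤⇒⟦≤⟧≡1 s≤x) (sym (≤⇒⟦≤⟧≡1 (≤-trans s≤x x≤y)))
⟦≤⟧-outside x≤y (inj₂ y<s) = trans (>⇒⟦≤⟧≡0 (≤-<-trans x≤y y<s)) (sym (>⇒⟦≤⟧≡0 y<s))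

+≡+⇒≤ : ∀ {a b α β} → a + α ≡ b + β → β ≤ α → a ≤ b
+≡+⇒≤ {a} {b} {α} eq β≤α = +-cancelʳ-≤ α a b (≤-trans (≤-reflexive eq) (+-monoʳ-≤ b β≤α))

count≥ : ℕ → List ℕ → ℕ
count≥ s xs = sum (map ⟦ s ≤_⟧ xs)

count≥-mono : ∀ s {xs ys} → Pointwise _≤_ xs ys → count≥ s xs ≤ count≥ s ys
count≥-mono s [] = z≤n
count≥-mono s (x≤y ∷ xs≤ys) = +-mono-≤ (⟦≤⟧-mono s x≤y) (count≥-mono s xs≤ys)

count≥≤length : ∀ s xs → count≥ s xs ≤ length xs
count≥≤length s [] = z≤n
count≥≤length s (x ∷ xs) = +-mono-≤ (⟦≤⟧≤1 s x) (count≥≤length s xs)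

count≥-all : ∀ {s} xs → All (s ≤_) xs → count≥ s xs ≡ length xs
count≥-all [] [] = refl
count≥-all (x ∷ xs) (s≤x ∷ s≤xs) = cong₂ _+_ (≤⇒⟦≤⟧≡1 s≤x) (count≥-all xs s≤xs)

count≥⇒pointwise : ∀ {xs ys} → AllPairs _≤_ xs → AllPairs _≤_ ys → length xs ≡ length ys →
  (∀ s → count≥ s xs ≤ count≥ s ys) → Pointwise _≤_ xs ys
count≥⇒pointwise {[]} {[]} _ _ _ _ = []
count≥⇒pointwise {x ∷ xs} {y ∷ ys} (x≤xs ∷ xs↗) (y≤ys ∷ ys↗) eq counts≤ =
  x≤y ∷ count≥⇒pointwise xs↗ ys↗ |xs|≡|ys| tail-counts≤
  where
  |xs|≡|ys| : length xs ≡ length ys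
  |xs|≡|ys| = suc-injective eq
  x≤y : x ≤ y
  x≤y with x ≤? y
  ... | yes x≤y = x≤y
  ... | no x≰y = contradiction (begin
      suc (length ys)              ≡⟨ cong suc (sym |xs|≡|ys|) ⟩
      length (x ∷ xs)              ≡⟨ sym (count≥-all (x ∷ xs) (≤-refl ∷ x≤xs)) ⟩
      count≥ x (x ∷ xs)            ≤⟨ counts≤ x ⟩
      ⟦ x ≤ y ⟧ + count≥ x ys       ≡⟨ cong (_+ count≥ x ys) (>⇒⟦≤⟧≡0 (≰⇒> x≰y)) ⟩
      count≥ x ys                  ≤⟨ count≥≤length x ys ⟩
      length ys                    ∎) (1+n≰n)
    where open ≤-Reasoning
  tail-counts≤ : ∀ s → count≥ s xs ≤ count≥ s ys
  tail-counts≤ s with s ≤? x | s ≤? y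
  ... | yes s≤x | _ = +-cancelˡ-≤ 1 _ _ (subst₂ _≤_
        (cong (_+ count≥ s xs) (≤⇒⟦≤⟧≡1 s≤x)) (cong (_+ count≥ s ys) (≤⇒⟦≤⟧≡1 (≤-trans s≤x x≤y))) (counts≤ s))
  ... | no s≰x | yes s≤y = begin
      count≥ s xs  ≤⟨ count≥≤length s xs ⟩
      length xs    ≡⟨ |xs|≡|ys| ⟩
      length ys    ≡⟨ sym (count≥-all ys (All-map (≤-trans s≤y) y≤ys)) ⟩
      count≥ s ys  ∎
    where open ≤-Reasoning
  ... | no s≰x | no s≰y = subst₂ _≤_
        (cong (_+ count≥ s xs) (>⇒⟦≤⟧≡0 (≰⇒> s≰x))) (cong (_+ count≥ s ys) (>⇒⟦≤⟧≡0 (≰⇒> s≰y))) (counts≤ s)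

rows≥ : (ℕ → ℕ) → ℕ → ℕ → ℕ
rows≥ h zero s = 0
rows≥ h (suc M) s = rows≥ h M s + ⟦ s ≤ h M ⟧

rows≥-unfoldˡ : ∀ h M s → rows≥ h (suc M) s ≡ ⟦ s ≤ h 0 ⟧ + rows≥ (h ∘′ suc) M s
rows≥-unfoldˡ h zero s = +-comm 0 _
rows≥-unfoldˡ h (suc M) s = begin
  rows≥ h (suc M) s + ⟦ s ≤ h (suc M) ⟧                       ≡⟨ cong (_+ ⟦ s ≤ h (suc M) ⟧) (rows≥-unfoldˡ h M s) ⟩
  ⟦ s ≤ h 0 ⟧ + rows≥ (h ∘′ suc) M s + ⟦ s ≤ h (suc M) ⟧       ≡⟨ +-assoc ⟦ s ≤ h 0 ⟧ _ _ ⟩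
  ⟦ s ≤ h 0 ⟧ + (rows≥ (h ∘′ suc) M s + ⟦ s ≤ h (suc M) ⟧)     ∎
  where open ≡-Reasoning

rows≥-cong-below : ∀ {y z M} → (∀ {q} → q < M → y q ≡ z q) → ∀ s → rows≥ y M s ≡ rows≥ z M s
rows≥-cong-below {M = zero} _ s = refl
rows≥-cong-below {M = suc M} y≡z s = cong₂ _+_ (rows≥-cong-below (y≡z ∘′ m<n⇒m<1+n) s) (cong ⟦ s ≤_⟧ (y≡z ≤-refl))

rows≥-≤ : ∀ h M s → rows≥ h M s ≤ M
rows≥-≤ h zero s = z≤n
rows≥-≤ h (suc M) s = subst (rows≥ h M s + ⟦ s ≤ h M ⟧ ≤_) (+-comm M 1) (+-mono-≤ (rows≥-≤ h M s) (⟦≤⟧≤1 s (h M)))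

rows≥-all : ∀ {h M s} → (∀ {q} → q < M → s ≤ h q) → rows≥ h M s ≡ M
rows≥-all {M = zero} _ = refl
rows≥-all {h} {suc M} {s} s≤h = trans (cong₂ _+_ (rows≥-all (s≤h ∘′ m<n⇒m<1+n)) (≤⇒⟦≤⟧≡1 (s≤h ≤-refl))) (+-comm M 1)

⟦≤⟧-row : ∀ z h r s → rows≥ z r s ≡ rows≥ h r s → rows≥ z (suc r) s ≡ rows≥ h (suc r) s → ⟦ s ≤ z r ⟧ ≡ ⟦ s ≤ h r ⟧
⟦≤⟧-row z h r s eq eq′ = +-cancelˡ-≡ (rows≥ h r s) _ _ (trans (cong (_+ ⟦ s ≤ z r ⟧) (sym eq)) eq′)

update : (ℕ → ℕ) → ℕ → ℕ → ℕ → ℕ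
update h m v r with r ≟ m
... | yes _ = v
... | no _ = h r

update-≡ : ∀ h m v → update h m v m ≡ v
update-≡ h m v with m ≟ m
... | yes _ = refl
... | no m≢m = contradiction refl m≢m

update-≢ : ∀ h {m} v {r} → r ≢ m → update h m v r ≡ h r
update-≢ h {m} v {r} r≢m with r ≟ m
... | yes r≡m = contradiction r≡m r≢m
... | no _ = refl

rows≥-update-below : ∀ h {m} v {M} s → M ≤ m → rows≥ (update h m v) M s ≡ rows≥ h M s
rows≥-update-below h v {zero} s _ = refl
rows≥-update-below h v {suc M} s M<m =
  cong₂ _+_ (rows≥-update-below h v s (<⇒≤ M<m)) (cong ⟦ s ≤_⟧ (update-≢ h v (<⇒≢ M<m)))

rows≥-update-above : ∀ h {m} v {M} s → m < M → rows≥ (update h m v) M s + ⟦ s ≤ h m ⟧ ≡ rows≥ h M s + ⟦ s ≤ v ⟧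
rows≥-update-above h {m} v {suc M} s (s≤s m≤M) with m ≟ M
... | yes refl = begin
  rows≥ (update h m v) m s + ⟦ s ≤ update h m v m ⟧ + ⟦ s ≤ h m ⟧
    ≡⟨ cong₂ (λ a b → a + ⟦ s ≤ b ⟧ + ⟦ s ≤ h m ⟧) (rows≥-update-below h {m} v s ≤-refl) (update-≡ h m v) ⟩
  rows≥ h m s + ⟦ s ≤ v ⟧ + ⟦ s ≤ h m ⟧
    ≡⟨ xy∙z≈xz∙y (rows≥ h m s) _ _ ⟩
  rows≥ h m s + ⟦ s ≤ h m ⟧ + ⟦ s ≤ v ⟧ ∎
  where open ≡-Reasoning
... | no m≢M = begin
  rows≥ (update h m v) M s + ⟦ s ≤ update h m v M ⟧ + ⟦ s ≤ h m ⟧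
    ≡⟨ cong (λ b → rows≥ (update h m v) M s + ⟦ s ≤ b ⟧ + ⟦ s ≤ h m ⟧) (update-≢ h v (m≢M ∘′ sym)) ⟩
  rows≥ (update h m v) M s + ⟦ s ≤ h M ⟧ + ⟦ s ≤ h m ⟧
    ≡⟨ xy∙z≈xz∙y (rows≥ (update h m v) M s) ⟦ s ≤ h M ⟧ ⟦ s ≤ h m ⟧ ⟩
  rows≥ (update h m v) M s + ⟦ s ≤ h m ⟧ + ⟦ s ≤ h M ⟧
    ≡⟨ cong (_+ ⟦ s ≤ h M ⟧) (rows≥-update-above h v s (≤∧≢⇒< m≤M m≢M)) ⟩
  rows≥ h M s + ⟦ s ≤ v ⟧ + ⟦ s ≤ h M ⟧
    ≡⟨ xy∙z≈xz∙y (rows≥ h M s) ⟦ s ≤ v ⟧ ⟦ s ≤ h M ⟧ ⟩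
  rows≥ h M s + ⟦ s ≤ h M ⟧ + ⟦ s ≤ v ⟧ ∎
  where open ≡-Reasoning

swap : (ℕ → ℕ) → ℕ → ℕ → ℕ → ℕ
swap h m k = update (update h m (h k)) k (h m)

swap-≡ˡ : ∀ h {m k} → m ≢ k → swap h m k m ≡ h k
swap-≡ˡ h {m} {k} m≢k = trans (update-≢ _ (h m) m≢k) (update-≡ h m (h k))

swap-≡ʳ : ∀ h m k → swap h m k k ≡ h m
swap-≡ʳ h m k = update-≡ _ k (h m)

swap-≢ : ∀ h {m k r} → r ≢ m → r ≢ k → swap h m k r ≡ h r
swap-≢ h {m} {k} r≢m r≢k = trans (update-≢ _ (h m) r≢k) (update-≢ h (h k) r≢m)

rows≥-swap-below : ∀ h {m k M} s → m < k → M ≤ m → rows≥ (swap h m k) M s ≡ rows≥ h M s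
rows≥-swap-below h {m} {k} s m<k M≤m =
  trans (rows≥-update-below _ (h m) s (≤-trans M≤m (<⇒≤ m<k))) (rows≥-update-below h (h k) s M≤m)

rows≥-swap-between : ∀ h {m k M} s → m < M → M ≤ k → rows≥ (swap h m k) M s + ⟦ s ≤ h m ⟧ ≡ rows≥ h M s + ⟦ s ≤ h k ⟧
rows≥-swap-between h {m} {k} s m<M M≤k =
  trans (cong (_+ ⟦ s ≤ h m ⟧) (rows≥-update-below _ (h m) s M≤k)) (rows≥-update-above h (h k) s m<M)

rows≥-swap-above : ∀ h {m k M} s → m < k → k < M → rows≥ (swap h m k) M s ≡ rows≥ h M s
rows≥-swap-above h {m} {k} {M} s m<k k<M = +-cancelʳ-≡ (⟦ s ≤ h k ⟧ + ⟦ s ≤ h m ⟧) _ _ (begin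
  rows≥ (swap h m k) M s + (⟦ s ≤ h k ⟧ + ⟦ s ≤ h m ⟧)
    ≡⟨ +-assoc (rows≥ (swap h m k) M s) _ _ ⟨
  rows≥ (swap h m k) M s + ⟦ s ≤ h k ⟧ + ⟦ s ≤ h m ⟧
    ≡⟨ cong (λ b → rows≥ (swap h m k) M s + ⟦ s ≤ b ⟧ + ⟦ s ≤ h m ⟧) (update-≢ h (h k) (<⇒≢ m<k ∘′ sym)) ⟨
  rows≥ (swap h m k) M s + ⟦ s ≤ update h m (h k) k ⟧ + ⟦ s ≤ h m ⟧
    ≡⟨ cong (_+ ⟦ s ≤ h m ⟧) (rows≥-update-above (update h m (h k)) (h m) s k<M) ⟩
  rows≥ (update h m (h k)) M s + ⟦ s ≤ h m ⟧ + ⟦ s ≤ h m ⟧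
    ≡⟨ cong (_+ ⟦ s ≤ h m ⟧) (rows≥-update-above h (h k) s (<-trans m<k k<M)) ⟩
  rows≥ h M s + ⟦ s ≤ h k ⟧ + ⟦ s ≤ h m ⟧
    ≡⟨ +-assoc (rows≥ h M s) _ _ ⟩
  rows≥ h M s + (⟦ s ≤ h k ⟧ + ⟦ s ≤ h m ⟧) ∎)
  where open ≡-Reasoning

InjectiveBelow : (ℕ → ℕ) → ℕ → Set
InjectiveBelow h M = ∀ {q r} → q < M → r < M → h q ≡ h r → q ≡ r

InjectiveBelow-suc⁻ : ∀ {h M} → InjectiveBelow h (suc M) → InjectiveBelow h M
InjectiveBelow-suc⁻ inj q<M r<M = inj (m<n⇒m<1+n q<M) (m<n⇒m<1+n r<M)

transpose : ℕ → ℕ → ℕ → ℕ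
transpose m k r with r ≟ m | r ≟ k
... | yes _ | _ = k
... | no _ | yes _ = m
... | no _ | no _ = r

transpose-≡ˡ : ∀ m k → transpose m k m ≡ k
transpose-≡ˡ m k with m ≟ m
... | yes _ = refl
... | no m≢m = contradiction refl m≢m

transpose-≡ʳ : ∀ {m k} → m ≢ k → transpose m k k ≡ m
transpose-≡ʳ {m} {k} m≢k with k ≟ m | k ≟ k
... | yes k≡m | _ = contradiction (sym k≡m) m≢k
... | no _ | yes _ = refl
... | no _ | no k≢k = contradiction refl k≢k

transpose-≢ : ∀ {m k r} → r ≢ m → r ≢ k → transpose m k r ≡ r
transpose-≢ {m} {k} {r} r≢m r≢k with r ≟ m | r ≟ k
... | yes r≡m | _ = contradiction r≡m r≢m
... | no _ | yes r≡k = contradiction r≡k r≢k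
... | no _ | no _ = refl

swap≡∘transpose : ∀ h {m k} → m ≢ k → ∀ r → swap h m k r ≡ h (transpose m k r)
swap≡∘transpose h {m} {k} m≢k r = cases (r ≟ m) (r ≟ k)
  where
  cases : Dec (r ≡ m) → Dec (r ≡ k) → swap h m k r ≡ h (transpose m k r)
  cases (yes refl) _ = trans (swap-≡ˡ h m≢k) (cong h (sym (transpose-≡ˡ m k)))
  cases (no _) (yes refl) = trans (swap-≡ʳ h m k) (cong h (sym (transpose-≡ʳ m≢k)))
  cases (no r≢m) (no r≢k) = trans (swap-≢ h r≢m r≢k) (cong h (sym (transpose-≢ r≢m r≢k)))

transpose-involutive : ∀ {m k} → m ≢ k → ∀ r → transpose m k (transpose m k r) ≡ r
transpose-involutive {m} {k} m≢k r = cases (r ≟ m) (r ≟ k)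
  where
  cases : Dec (r ≡ m) → Dec (r ≡ k) → transpose m k (transpose m k r) ≡ r
  cases (yes refl) _ = trans (cong (transpose m k) (transpose-≡ˡ m k)) (transpose-≡ʳ m≢k)
  cases (no _) (yes refl) = trans (cong (transpose m k) (transpose-≡ʳ m≢k)) (transpose-≡ˡ m k)
  cases (no r≢m) (no r≢k) = trans (cong (transpose m k) (transpose-≢ r≢m r≢k)) (transpose-≢ r≢m r≢k)

transpose-< : ∀ {m k r N} → m < N → k < N → r < N → transpose m k r < N
transpose-< {m} {k} {r} m<N k<N r<N with r ≟ m | r ≟ k
... | yes _ | _ = k<N
... | no _ | yes _ = m<N
... | no _ | no _ = r<N

swap-injective : ∀ {h m k N} → m < N → k < N → m ≢ k → InjectiveBelow h N → InjectiveBelow (swap h m k) N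
swap-injective {h} {m} {k} m<N k<N m≢k inj {q} {r} q<N r<N swap-q≡swap-r = begin
  q                                 ≡⟨ transpose-involutive m≢k q ⟨
  transpose m k (transpose m k q)   ≡⟨ cong (transpose m k) (inj (transpose-< m<N k<N q<N) (transpose-< m<N k<N r<N) h-eq) ⟩
  transpose m k (transpose m k r)   ≡⟨ transpose-involutive m≢k r ⟩
  r                                 ∎
  where
  open ≡-Reasoning
  h-eq = trans (sym (swap≡∘transpose h m≢k q)) (trans swap-q≡swap-r (swap≡∘transpose h m≢k r))

update-injective : ∀ {h m v N} → InjectiveBelow h N → (∀ {q} → q < N → q ≢ m → h q ≢ v) →
  InjectiveBelow (update h m v) N
update-injective {h} {m} {v} inj fresh {q} {r} q<N r<N eq = cases (q ≟ m) (r ≟ m)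
  where
  cases : Dec (q ≡ m) → Dec (r ≡ m) → q ≡ r
  cases (yes q≡m) (yes r≡m) = trans q≡m (sym r≡m)
  cases (yes refl) (no r≢m) =
    contradiction (trans (sym (update-≢ h v r≢m)) (trans (sym eq) (update-≡ h q v))) (fresh r<N r≢m)
  cases (no q≢m) (yes refl) =
    contradiction (trans (sym (update-≢ h v q≢m)) (trans eq (update-≡ h r v))) (fresh q<N q≢m)
  cases (no q≢m) (no r≢m) = inj q<N r<N (trans (sym (update-≢ h v q≢m)) (trans eq (update-≢ h v r≢m)))

-- A move of row m (exchanging it with row k, or lowering it from b to a) changes the count of values ≥ s
-- among the first M rows only for m < M ≤ k and a < s ≤ b.
data OffWindow (m k a b M s : ℕ) : Set where
  rows-before : M ≤ m → OffWindow m k a b M s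
  rows-after : k < M → OffWindow m k a b M s
  values-below : s ≤ a → OffWindow m k a b M s
  values-above : b < s → OffWindow m k a b M s

record InWindow (m k a b M s : ℕ) : Set where
  field
    m<M : m < M
    M≤k : M ≤ k
    a<s : a < s
    s≤b : s ≤ b

offWindow? : ∀ m k a b M s → OffWindow m k a b M s ⊎ InWindow m k a b M s
offWindow? m k a b M s with m <? M | M ≤? k | a <? s | s ≤? b
... | no m≮M | _ | _ | _ = inj₁ (rows-before (≮⇒≥ m≮M))
... | _ | no M≰k | _ | _ = inj₁ (rows-after (≰⇒> M≰k))
... | _ | _ | no a≮s | _ = inj₁ (values-below (≮⇒≥ a≮s))
... | _ | _ | _ | no s≰b = inj₁ (values-above (≰⇒> s≰b))
... | yes m<M | yes M≤k | yes a<s | yes s≤b = inj₂ record { m<M = m<M ; M≤k = M≤k ; a<s = a<s ; s≤b = s≤b }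

rows≥-swap-off : ∀ h {m k M s} → m < k → h k ≤ h m → OffWindow m k (h k) (h m) M s →
  rows≥ (swap h m k) M s ≡ rows≥ h M s
rows≥-swap-off h m<k _ (rows-before M≤m) = rows≥-swap-below h _ m<k M≤m
rows≥-swap-off h m<k _ (rows-after k<M) = rows≥-swap-above h _ m<k k<M
rows≥-swap-off h {m} {k} {M} {s} m<k hk≤hm off-values with m <? M | M ≤? k
... | no m≮M | _ = rows≥-swap-below h s m<k (≮⇒≥ m≮M)
... | yes _ | no M≰k = rows≥-swap-above h s m<k (≰⇒> M≰k)
... | yes m<M | yes M≤k = +-cancelʳ-≡ ⟦ s ≤ h m ⟧ _ _ (trans (rows≥-swap-between h s m<M M≤k)
      (cong (rows≥ h M s +_) (⟦≤⟧-outside hk≤hm (values off-values))))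
  where
  values : OffWindow m k (h k) (h m) M s → s ≤ h k ⊎ h m < s
  values (values-below s≤a) = inj₁ s≤a
  values (values-above b<s) = inj₂ b<s
  values (rows-before M≤m) = contradiction M≤m (<⇒≱ m<M)
  values (rows-after k<M) = contradiction M≤k (<⇒≱ k<M)

rows≥-update-off : ∀ h {m K v M s} → v ≤ h m → M ≤ K → OffWindow m K v (h m) M s →
  rows≥ (update h m v) M s ≡ rows≥ h M s
rows≥-update-off h v≤hm _ (rows-before M≤m) = rows≥-update-below h _ _ M≤m
rows≥-update-off h v≤hm M≤K (rows-after K<M) = contradiction M≤K (<⇒≱ K<M)
rows≥-update-off h {m} {K} {v} {M} {s} v≤hm M≤K off-values with m <? M
... | no m≮M = rows≥-update-below h v s (≮⇒≥ m≮M)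
... | yes m<M = +-cancelʳ-≡ ⟦ s ≤ h m ⟧ _ _ (trans (rows≥-update-above h v s m<M)
      (cong (rows≥ h M s +_) (⟦≤⟧-outside v≤hm (values off-values))))
  where
  values : OffWindow m K v (h m) M s → s ≤ v ⊎ h m < s
  values (values-below s≤a) = inj₁ s≤a
  values (values-above b<s) = inj₂ b<s
  values (rows-before M≤m) = contradiction M≤m (<⇒≱ m<M)
  values (rows-after K<M) = contradiction M≤K (<⇒≱ K<M)

rows≥-swap-in : ∀ h {m k M s} → InWindow m k (h k) (h m) M s → rows≥ (swap h m k) M s + 1 ≡ rows≥ h M s
rows≥-swap-in h {m} {k} {M} {s} record { m<M = m<M ; M≤k = M≤k ; a<s = hk<s ; s≤b = s≤hm } = begin
  rows≥ (swap h m k) M s + 1                ≡⟨ cong (rows≥ (swap h m k) M s +_) (≤⇒⟦≤⟧≡1 s≤hm) ⟨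
  rows≥ (swap h m k) M s + ⟦ s ≤ h m ⟧      ≡⟨ rows≥-swap-between h s m<M M≤k ⟩
  rows≥ h M s + ⟦ s ≤ h k ⟧                 ≡⟨ cong (rows≥ h M s +_) (>⇒⟦≤⟧≡0 hk<s) ⟩
  rows≥ h M s + 0                           ≡⟨ +-identityʳ _ ⟩
  rows≥ h M s                               ∎
  where open ≡-Reasoning

rows≥-update-in : ∀ h {m K v M s} → InWindow m K v (h m) M s → rows≥ (update h m v) M s + 1 ≡ rows≥ h M s
rows≥-update-in h {m} {K} {v} {M} {s} record { m<M = m<M ; a<s = v<s ; s≤b = s≤hm } = begin
  rows≥ (update h m v) M s + 1              ≡⟨ cong (rows≥ (update h m v) M s +_) (≤⇒⟦≤⟧≡1 s≤hm) ⟨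
  rows≥ (update h m v) M s + ⟦ s ≤ h m ⟧    ≡⟨ rows≥-update-above h v s m<M ⟩
  rows≥ h M s + ⟦ s ≤ v ⟧                   ≡⟨ cong (rows≥ h M s +_) (>⇒⟦≤⟧≡0 v<s) ⟩
  rows≥ h M s + 0                           ≡⟨ +-identityʳ _ ⟩
  rows≥ h M s                               ∎
  where open ≡-Reasoning

rows≥-lagging : ∀ {y h m s} → (∀ {q} → q < m → y q ≡ h q) → y m < s → s ≤ h m →
  ∀ {M} → m < M → (∀ {r} → m < r → r < M → s ≤ h r) → suc (rows≥ y M s) ≤ rows≥ h M s
rows≥-lagging {y} {h} {m} {s} agree ym<s s≤hm {suc M} (s≤s m≤M) s≤h with m ≟ M
... | yes refl = ≤-reflexive (begin
  suc (rows≥ y m s + ⟦ s ≤ y m ⟧)   ≡⟨ cong₂ (λ a b → suc (a + b)) (rows≥-cong-below agree s) (>⇒⟦≤⟧≡0 ym<s) ⟩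
  suc (rows≥ h m s + 0)             ≡⟨ cong suc (+-identityʳ _) ⟩
  suc (rows≥ h m s)                 ≡⟨ +-comm 1 _ ⟩
  rows≥ h m s + 1                   ≡⟨ cong (rows≥ h m s +_) (≤⇒⟦≤⟧≡1 s≤hm) ⟨
  rows≥ h m s + ⟦ s ≤ h m ⟧         ∎)
  where open ≡-Reasoning
... | no m≢M = begin
  suc (rows≥ y M s + ⟦ s ≤ y M ⟧)   ≤⟨ s≤s (+-monoʳ-≤ (rows≥ y M s) (⟦≤⟧≤1 s (y M))) ⟩
  suc (rows≥ y M s) + 1             ≤⟨ +-monoˡ-≤ 1 (rows≥-lagging agree ym<s s≤hm m<M (λ m<r r<M → s≤h m<r (m<n⇒m<1+n r<M))) ⟩
  rows≥ h M s + 1                   ≡⟨ cong (rows≥ h M s +_) (≤⇒⟦≤⟧≡1 (s≤h m<M ≤-refl)) ⟨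
  rows≥ h M s + ⟦ s ≤ h M ⟧         ∎
  where
  open ≤-Reasoning
  m<M = ≤∧≢⇒< m≤M m≢M

countBelow : ∀ {P : Pred ℕ 0ℓ} → Decidable P → ℕ → ℕ
countBelow P? N = length (filter P? (downFrom N))

countBelow-mono : ∀ {P Q : Pred ℕ 0ℓ} (P? : Decidable P) (Q? : Decidable Q) N →
  (∀ {w} → w < N → P w → Q w) → countBelow P? N ≤ countBelow Q? N
countBelow-mono P? Q? zero P⇒Q = z≤n
countBelow-mono P? Q? (suc N) P⇒Q with P? N | Q? N
... | yes _ | yes _ = s≤s (countBelow-mono P? Q? N (P⇒Q ∘′ m<n⇒m<1+n))
... | yes p | no ¬q = contradiction (P⇒Q ≤-refl p) ¬q
... | no _  | yes _ = m≤n⇒m≤1+n (countBelow-mono P? Q? N (P⇒Q ∘′ m<n⇒m<1+n))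
... | no _  | no _ = countBelow-mono P? Q? N (P⇒Q ∘′ m<n⇒m<1+n)

countBelow-cong : ∀ {P Q : Pred ℕ 0ℓ} (P? : Decidable P) (Q? : Decidable Q) N →
  (∀ {w} → w < N → P w → Q w) → (∀ {w} → w < N → Q w → P w) → countBelow P? N ≡ countBelow Q? N
countBelow-cong P? Q? N P⇒Q Q⇒P = ≤-antisym (countBelow-mono P? Q? N P⇒Q) (countBelow-mono Q? P? N Q⇒P)

countBelow-empty : ∀ {P : Pred ℕ 0ℓ} (P? : Decidable P) N → (∀ {w} → w < N → ¬ P w) → countBelow P? N ≡ 0
countBelow-empty P? zero ¬P = refl
countBelow-empty P? (suc N) ¬P with P? N
... | yes PN = contradiction PN (¬P ≤-refl)
... | no _ = countBelow-empty P? N (¬P ∘′ m<n⇒m<1+n)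

countBelow-insert : ∀ {P Q : Pred ℕ 0ℓ} (P? : Decidable P) (Q? : Decidable Q) {a} N →
  (∀ {w} → w < N → Q w → P w ⊎ w ≡ a) → (∀ {w} → P w → Q w) → Q a → ¬ P a → a < N →
  countBelow Q? N ≡ suc (countBelow P? N)
countBelow-insert P? Q? {a} (suc N) Q⇒P∪a P⇒Q Qa ¬Pa a<1+N with N ≟ a
... | yes refl with P? N | Q? N
...   | yes Pa | _ = contradiction Pa ¬Pa
...   | no _ | no ¬Qa = contradiction Qa ¬Qa
...   | no _ | yes _ = cong suc (countBelow-cong Q? P? N
        (λ w<N Qw → [ (λ Pw → Pw) , (λ w≡a → contradiction w≡a (<⇒≢ w<N)) ]′ (Q⇒P∪a (m<n⇒m<1+n w<N) Qw)) (λ _ → P⇒Q))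
countBelow-insert P? Q? {a} (suc N) Q⇒P∪a P⇒Q Qa ¬Pa a<1+N | no N≢a with P? N | Q? N
...   | yes _ | yes _ = cong suc ih
  where ih = countBelow-insert P? Q? N (Q⇒P∪a ∘′ m<n⇒m<1+n) P⇒Q Qa ¬Pa (≤∧≢⇒< (≤-pred a<1+N) (N≢a ∘′ sym))
...   | yes PN | no ¬QN = contradiction (P⇒Q PN) ¬QN
...   | no ¬PN | yes QN = contradiction (Q⇒P∪a ≤-refl QN) [ ¬PN , N≢a ]′
...   | no _ | no _ = countBelow-insert P? Q? N (Q⇒P∪a ∘′ m<n⇒m<1+n) P⇒Q Qa ¬Pa (≤∧≢⇒< (≤-pred a<1+N) (N≢a ∘′ sym))

countBelow-suc-yes : ∀ {P : Pred ℕ 0ℓ} (P? : Decidable P) {N} → P N → countBelow P? (suc N) ≡ suc (countBelow P? N)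
countBelow-suc-yes P? {N} PN with P? N
... | yes _ = refl
... | no ¬PN = contradiction PN ¬PN

countBelow-suc-no : ∀ {P : Pred ℕ 0ℓ} (P? : Decidable P) {N} → ¬ P N → countBelow P? (suc N) ≡ countBelow P? N
countBelow-suc-no P? {N} ¬PN with P? N
... | yes PN = contradiction PN ¬PN
... | no _ = refl

countBelow-≥ : ∀ s N → countBelow (s ≤?_) N ≡ N ∸ s
countBelow-≥ s zero = sym (0∸n≡0 s)
countBelow-≥ s (suc N) with s ≤? N
... | yes s≤N = trans (countBelow-suc-yes (s ≤?_) s≤N) (trans (cong suc (countBelow-≥ s N)) (sym (+-∸-assoc 1 s≤N)))
... | no s≰N = trans (countBelow-suc-no (s ≤?_) s≰N)
  (trans (countBelow-≥ s N) (trans (m≤n⇒m∸n≡0 (<⇒≤ (≰⇒> s≰N))) (sym (m≤n⇒m∸n≡0 (≰⇒> s≰N)))))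

countBelow-split : ∀ {P Q : Pred ℕ 0ℓ} (P? : Decidable P) (Q? : Decidable Q) N →
  countBelow (λ w → P? w ×-dec Q? w) N + countBelow (λ w → P? w ×-dec ¬? (Q? w)) N ≡ countBelow P? N
countBelow-split P? Q? zero = refl
countBelow-split P? Q? (suc N) with P? N | Q? N
... | yes _ | yes _ = cong suc (countBelow-split P? Q? N)
... | yes _ | no _ = trans (+-suc _ _) (cong suc (countBelow-split P? Q? N))
... | no _ | yes _ = countBelow-split P? Q? N
... | no _ | no _ = countBelow-split P? Q? N

UsedBelow : (ℕ → ℕ) → ℕ → ℕ → Set
UsedBelow h M w = ∃ λ q → q < M × h q ≡ w

UsedBelow-mono : ∀ {h M M′ w} → M ≤ M′ → UsedBelow h M w → UsedBelow h M′ w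
UsedBelow-mono M≤M′ (q , q<M , hq≡w) = q , <-≤-trans q<M M≤M′ , hq≡w

UsedBelow-suc⁻ : ∀ {h M w} → UsedBelow h (suc M) w → UsedBelow h M w ⊎ h M ≡ w
UsedBelow-suc⁻ (q , q<1+M , hq≡w) with m<1+n⇒m<n∨m≡n q<1+M
... | inj₁ q<M = inj₁ (q , q<M , hq≡w)
... | inj₂ refl = inj₂ hq≡w

usedBelow? : ∀ h M → Decidable (UsedBelow h M)
usedBelow? h zero w = no λ ()
usedBelow? h (suc M) w with h M ≟ w | usedBelow? h M w
... | yes hM≡w | _ = yes (M , ≤-refl , hM≡w)
... | no _ | yes used = yes (UsedBelow-mono (n≤1+n M) used)
... | no hM≢w | no ¬used = no λ used → [ ¬used , hM≢w ]′ (UsedBelow-suc⁻ used)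

rows≥≡countBelow-used : ∀ h {M N} s → InjectiveBelow h M → (∀ {q} → q < M → h q < N) →
  rows≥ h M s ≡ countBelow (λ w → s ≤? w ×-dec usedBelow? h M w) N
rows≥≡countBelow-used h {zero} {N} s _ _ = sym (countBelow-empty _ N λ _ ())
rows≥≡countBelow-used h {suc M} {N} s inj h<N with s ≤? h M
... | yes s≤hM = begin
  rows≥ h M s + ⟦ s ≤ h M ⟧
    ≡⟨ cong (rows≥ h M s +_) (≤⇒⟦≤⟧≡1 s≤hM) ⟩
  rows≥ h M s + 1
    ≡⟨ +-comm _ 1 ⟩
  suc (rows≥ h M s)
    ≡⟨ cong suc (rows≥≡countBelow-used h s (InjectiveBelow-suc⁻ inj) (h<N ∘′ m<n⇒m<1+n)) ⟩
  suc (countBelow (λ w → s ≤? w ×-dec usedBelow? h M w) N)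
    ≡⟨ countBelow-insert _ _ N
        (λ _ (s≤w , used) → Data.Sum.map (s≤w ,_) sym (UsedBelow-suc⁻ used))
        (λ (s≤w , used) → s≤w , UsedBelow-mono (n≤1+n M) used)
        (s≤hM , M , ≤-refl , refl)
        (λ (_ , q , q<M , hq≡hM) → <⇒≢ q<M (inj (m<n⇒m<1+n q<M) ≤-refl hq≡hM))
        (h<N ≤-refl) ⟨
  countBelow (λ w → s ≤? w ×-dec usedBelow? h (suc M) w) N ∎
  where open ≡-Reasoning
... | no s≰hM = begin
  rows≥ h M s + ⟦ s ≤ h M ⟧
    ≡⟨ cong (rows≥ h M s +_) (>⇒⟦≤⟧≡0 (≰⇒> s≰hM)) ⟩
  rows≥ h M s + 0
    ≡⟨ +-identityʳ _ ⟩
  rows≥ h M s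
    ≡⟨ rows≥≡countBelow-used h s (InjectiveBelow-suc⁻ inj) (h<N ∘′ m<n⇒m<1+n) ⟩
  countBelow (λ w → s ≤? w ×-dec usedBelow? h M w) N
    ≡⟨ countBelow-cong _ _ N
        (λ _ (s≤w , used) → s≤w , UsedBelow-mono (n≤1+n M) used)
        (λ _ (s≤w , used) → s≤w , [ id , (λ { refl → contradiction s≤w s≰hM }) ]′ (UsedBelow-suc⁻ used)) ⟩
  countBelow (λ w → s ≤? w ×-dec usedBelow? h (suc M) w) N ∎
  where open ≡-Reasoning

covering-values-≤-rows : ∀ {h M B} → InjectiveBelow h M → (∀ {q} → q < M → h q ≤ B) →
  (∀ {w} → 1 ≤ w → w ≤ B → UsedBelow h M w) → B ≤ M
covering-values-≤-rows {h} {M} {B} inj h≤B covers = begin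
  B                                                        ≡⟨ countBelow-≥ 1 (suc B) ⟨
  countBelow (1 ≤?_) (suc B)                               ≤⟨ countBelow-mono (1 ≤?_) (λ w → 1 ≤? w ×-dec usedBelow? h M w) (suc B)
                                                                (λ w<1+B 1≤w → 1≤w , covers 1≤w (≤-pred w<1+B)) ⟩
  countBelow (λ w → 1 ≤? w ×-dec usedBelow? h M w) (suc B) ≡⟨ rows≥≡countBelow-used h 1 inj (s≤s ∘′ h≤B) ⟨
  rows≥ h M 1                                               ≤⟨ rows≥-≤ h M 1 ⟩
  M                                                        ∎
  where open ≤-Reasoning

fresh⇒injective : ∀ {h M} → (∀ {r} → r < M → ¬ UsedBelow h r (h r)) → InjectiveBelow h M
fresh⇒injective {h} fresh {q} {r} q<M r<M hq≡hr with <-cmp q r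
... | tri< q<r _ _ = contradiction (q , q<r , hq≡hr) (fresh r<M)
... | tri≈ _ q≡r _ = q≡r
... | tri> _ _ r<q = contradiction (r , r<q , sym hq≡hr) (fresh q<M)

record FirstDifference (y h : ℕ → ℕ) (m : ℕ) : Set where
  field
    agrees : ∀ {q} → q < m → y q ≡ h q
    differs : y m ≢ h m

firstDifference? : ∀ y h N → (∀ r → r < N → y r ≡ h r) ⊎ (∃ λ m → m < N × FirstDifference y h m)
firstDifference? y h zero = inj₁ λ _ ()
firstDifference? y h (suc N) with firstDifference? y h N
... | inj₂ (m , m<N , diff) = inj₂ (m , m<n⇒m<1+n m<N , diff)
... | inj₁ agree with y N ≟ h N
...   | no yN≢hN = inj₂ (N , ≤-refl , record { agrees = λ {q} → agree q ; differs = yN≢hN })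
...   | yes yN≡hN = inj₁ λ r r<1+N → [ agree r , (λ { refl → yN≡hN }) ]′ (m<1+n⇒m<n∨m≡n r<1+N)

firstDifference-unique : ∀ {y h m m′} → FirstDifference y h m → FirstDifference y h m′ → m ≡ m′
firstDifference-unique {m = m} {m′} d d′ with <-cmp m m′
... | tri< m<m′ _ _ = contradiction (FirstDifference.agrees d′ m<m′) (FirstDifference.differs d)
... | tri≈ _ m≡m′ _ = m≡m′
... | tri> _ _ m′<m = contradiction (FirstDifference.agrees d m′<m) (FirstDifference.differs d′)

greatest-< : ∀ {P : Pred ℕ 0ℓ} → Decidable P → ∀ {w b} → w < b → P w →
  ∃ λ c → w ≤ c × c < b × P c × (∀ {u} → c < u → u < b → ¬ P u)
greatest-< P? {w} {suc b} w<1+b Pw with P? b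
... | yes Pb = b , ≤-pred w<1+b , ≤-refl , Pb , λ b<u u<1+b → contradiction (≤-pred u<1+b) (<⇒≱ b<u)
... | no ¬Pb with greatest-< P? (≤∧≢⇒< (≤-pred w<1+b) λ { refl → ¬Pb Pw }) Pw
...   | c , w≤c , c<b , Pc , beyond = c , w≤c , m<n⇒m<1+n c<b , Pc , beyond′
  where
  beyond′ : ∀ {u} → c < u → u < suc b → ¬ _
  beyond′ {u} c<u u<1+b with u ≟ b
  ... | yes refl = ¬Pb
  ... | no u≢b = beyond c<u (≤∧≢⇒< (≤-pred u<1+b) u≢b)

greatest-unused-< : ∀ {h M v b} → v < b → ¬ UsedBelow h M v →
  ∃ λ c → v ≤ c × c < b × ¬ UsedBelow h M c × (∀ {w} → c < w → w < b → UsedBelow h M w)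
greatest-unused-< {h} {M} v<b v-free with greatest-< (λ u → ¬? (usedBelow? h M u)) v<b v-free
... | c , v≤c , c<b , c-free , beyond = c , v≤c , c<b , c-free , λ c<w w<b → decidable-stable (usedBelow? h M _) (beyond c<w w<b)

-- The rook order as dominance of prefix counts

module Dominance (n : ℕ) where

  infix 4 _≐_ _⊑_

  _≐_ : (ℕ → ℕ) → (ℕ → ℕ) → Set
  y ≐ z = ∀ r → r < n → y r ≡ z r

  _⊑_ : (ℕ → ℕ) → (ℕ → ℕ) → Set
  y ⊑ z = ∀ M → M ≤ n → ∀ s → rows≥ y M s ≤ rows≥ z M s

  ≐-refl : ∀ {y} → y ≐ y
  ≐-refl _ _ = refl

  ≐-sym : ∀ {y z} → y ≐ z → z ≐ y
  ≐-sym y≐z r r<n = sym (y≐z r r<n)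

  ≐-trans : ∀ {x y z} → x ≐ y → y ≐ z → x ≐ z
  ≐-trans x≐y y≐z r r<n = trans (x≐y r r<n) (y≐z r r<n)

  ≐-except : ∀ {y z m} → y m ≡ z m → (∀ {r} → r < n → r ≢ m → y r ≡ z r) → y ≐ z
  ≐-except {m = m} ym≡zm others r r<n with r ≟ m
  ... | yes refl = ym≡zm
  ... | no r≢m = others r<n r≢m

  ≐-except₂ : ∀ {y z m k} → y m ≡ z m → y k ≡ z k → (∀ {r} → r < n → r ≢ m → r ≢ k → y r ≡ z r) → y ≐ z
  ≐-except₂ {y} {z} {m} {k} ym≡zm yk≡zk others = ≐-except ym≡zm except-m
    where
    except-m : ∀ {r} → r < n → r ≢ m → y r ≡ z r
    except-m {r} r<n r≢m with r ≟ k
    ... | yes refl = yk≡zk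
    ... | no r≢k = others r<n r≢m r≢k

  ≐-update : ∀ {y h m} → (∀ {r} → r < n → r ≢ m → y r ≡ h r) → y ≐ update h m (y m)
  ≐-update {y} {h} {m} others = ≐-except (sym (update-≡ h m (y m))) λ r<n r≢m → trans (others r<n r≢m) (sym (update-≢ h (y m) r≢m))

  FirstDifference-resp-≐ : ∀ {y z h m} → y ≐ z → m < n → FirstDifference y h m → FirstDifference z h m
  FirstDifference-resp-≐ y≐z m<n diff = record
    { agrees = λ q<m → trans (sym (y≐z _ (<-trans q<m m<n))) (agrees q<m)
    ; differs = λ zm≡hm → differs (trans (y≐z _ m<n) zm≡hm)
    }
    where open FirstDifference diff

  rows≥-cong : ∀ {y z} → y ≐ z → ∀ {M} → M ≤ n → ∀ s → rows≥ y M s ≡ rows≥ z M s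
  rows≥-cong y≐z M≤n = rows≥-cong-below λ q<M → y≐z _ (<-≤-trans q<M M≤n)

  ⊑-refl : ∀ {y} → y ⊑ y
  ⊑-refl M _ s = ≤-refl

  ⊑-trans : ∀ {x y z} → x ⊑ y → y ⊑ z → x ⊑ z
  ⊑-trans x⊑y y⊑z M M≤n s = ≤-trans (x⊑y M M≤n s) (y⊑z M M≤n s)

  ⊑-resp-≐ : ∀ {y y′ z z′} → y ≐ y′ → z ≐ z′ → y ⊑ z → y′ ⊑ z′
  ⊑-resp-≐ y≐y′ z≐z′ y⊑z M M≤n s =
    subst₂ _≤_ (rows≥-cong y≐y′ M≤n s) (rows≥-cong z≐z′ M≤n s) (y⊑z M M≤n s)

  update-mono : ∀ h m {v w} → v ≤ w → update h m v ⊑ update h m w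
  update-mono h m {v} {w} v≤w M _ s with m <? M
  ... | no m≮M = ≤-reflexive (trans (rows≥-update-below h v s (≮⇒≥ m≮M)) (sym (rows≥-update-below h w s (≮⇒≥ m≮M))))
  ... | yes m<M = +-cancelʳ-≤ ⟦ s ≤ h m ⟧ _ _ (subst₂ _≤_
        (sym (rows≥-update-above h v s m<M)) (sym (rows≥-update-above h w s m<M)) (+-monoʳ-≤ (rows≥ h M s) (⟦≤⟧-mono s v≤w)))

  update-self : ∀ h m → update h m (h m) ≐ h
  update-self h m r _ with r ≟ m
  ... | yes refl = refl
  ... | no _ = refl

  update-⊑ : ∀ h m {v} → v ≤ h m → update h m v ⊑ h
  update-⊑ h m v≤hm = ⊑-resp-≐ ≐-refl (update-self h m) (update-mono h m v≤hm)

  ⊑-update : ∀ h m {w} → h m ≤ w → h ⊑ update h m w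
  ⊑-update h m hm≤w = ⊑-resp-≐ (update-self h m) ≐-refl (update-mono h m hm≤w)

  swap-⊑ : ∀ h {m k} → m < k → h k ≤ h m → swap h m k ⊑ h
  swap-⊑ h {m} {k} m<k hk≤hm M _ s with m <? M | M ≤? k
  ... | no m≮M | _ = ≤-reflexive (rows≥-swap-below h s m<k (≮⇒≥ m≮M))
  ... | yes _ | no M≰k = ≤-reflexive (rows≥-swap-above h s m<k (≰⇒> M≰k))
  ... | yes m<M | yes M≤k = +≡+⇒≤ (rows≥-swap-between h s m<M M≤k) (⟦≤⟧-mono s hk≤hm)

  ⊑-swap : ∀ h {m k} → m < k → h m ≤ h k → h ⊑ swap h m k
  ⊑-swap h {m} {k} m<k hm≤hk M _ s with m <? M | M ≤? k
  ... | no m≮M | _ = ≤-reflexive (sym (rows≥-swap-below h s m<k (≮⇒≥ m≮M)))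
  ... | yes _ | no M≰k = ≤-reflexive (sym (rows≥-swap-above h s m<k (≰⇒> M≰k)))
  ... | yes m<M | yes M≤k = +≡+⇒≤ (sym (rows≥-swap-between h s m<M M≤k)) (⟦≤⟧-mono s hm≤hk)

  update-⊑-update : ∀ h {m k v} → m < k → v ≤ h m → h k ≤ h m → update h m v ⊑ update h k v
  update-⊑-update h {m} {k} {v} m<k v≤hm hk≤hm M _ s with m <? M | k <? M
  ... | no m≮M | _ = ≤-reflexive (trans (rows≥-update-below h v s (≮⇒≥ m≮M))
        (sym (rows≥-update-below h v s (≤-trans (≮⇒≥ m≮M) (<⇒≤ m<k)))))
  ... | yes m<M | no k≮M = subst (_ ≤_) (sym (rows≥-update-below h v s (≮⇒≥ k≮M)))
        (+≡+⇒≤ (rows≥-update-above h v s m<M) (⟦≤⟧-mono s v≤hm))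
  ... | yes m<M | yes k<M = +≡+⇒≤
        (trans (rows≥-update-above h v s m<M) (sym (rows≥-update-above h v s k<M))) (⟦≤⟧-mono s hk≤hm)

  swap-⊑-swap : ∀ h {m k r} → m < k → k < r → h r ≤ h m → h k ≤ h m → swap h m r ⊑ swap h k r
  swap-⊑-swap h {m} {k} {r} m<k k<r hr≤hm hk≤hm M _ s with m <? M | k <? M | r <? M
  ... | no m≮M | _ | _ = ≤-reflexive (trans (rows≥-swap-below h s (<-trans m<k k<r) (≮⇒≥ m≮M))
        (sym (rows≥-swap-below h s k<r (≤-trans (≮⇒≥ m≮M) (<⇒≤ m<k)))))
  ... | yes m<M | no k≮M | _ = subst (_ ≤_) (sym (rows≥-swap-below h s k<r (≮⇒≥ k≮M)))
        (+≡+⇒≤ (rows≥-swap-between h s m<M (≤-trans (≮⇒≥ k≮M) (<⇒≤ k<r))) (⟦≤⟧-mono s hr≤hm))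
  ... | yes m<M | yes k<M | no r≮M = +≡+⇒≤
        (trans (rows≥-swap-between h s m<M (≮⇒≥ r≮M)) (sym (rows≥-swap-between h s k<M (≮⇒≥ r≮M)))) (⟦≤⟧-mono s hk≤hm)
  ... | yes _ | yes _ | yes r<M = ≤-reflexive (trans (rows≥-swap-above h s (<-trans m<k k<r) r<M)
        (sym (rows≥-swap-above h s k<r r<M)))

  ⊑-confined-move : ∀ {y h f m k a} → y ⊑ h → (∀ {q} → q < m → y q ≡ h q) → y m ≤ a →
    (∀ {r} → m < r → r < k → h m < h r) →
    (∀ {M s} → M ≤ n → OffWindow m k a (h m) M s → rows≥ f M s ≡ rows≥ h M s) →
    (∀ {M s} → InWindow m k a (h m) M s → rows≥ f M s + 1 ≡ rows≥ h M s) → y ⊑ f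
  ⊑-confined-move {y} {h} {f} {m} {k} {a} y⊑h agree ym≤a between f-off f-in M M≤n s with offWindow? m k a (h m) M s
  ... | inj₁ off = subst (rows≥ y M s ≤_) (sym (f-off M≤n off)) (y⊑h M M≤n s)
  ... | inj₂ in-window = +-cancelʳ-≤ 1 _ _ (begin
    rows≥ y M s + 1    ≡⟨ +-comm _ 1 ⟩
    suc (rows≥ y M s)  ≤⟨ rows≥-lagging agree (≤-<-trans ym≤a a<s) s≤b m<M
                           (λ m<r r<M → ≤-trans s≤b (<⇒≤ (between m<r (<-≤-trans r<M M≤k)))) ⟩
    rows≥ h M s        ≡⟨ f-in in-window ⟨
    rows≥ f M s + 1    ∎)
    where
    open InWindow in-window
    open ≤-Reasoning

-- Rows are indexed from 0; at x r = 0 for r ≥ n, and every use below is guarded by r < n.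
at : ∀ {n} → Vec ℕ n → ℕ → ℕ
at [] r = 0
at (a ∷ xs) zero = a
at (a ∷ xs) (suc r) = at xs r

lookup≡at : ∀ {n} (x : Vec ℕ n) (f : Fin n) → lookup x f ≡ at x (toℕ f)
lookup≡at (a ∷ xs) fzero = refl
lookup≡at (a ∷ xs) (fsuc f) = lookup≡at xs f

count≥-take≡rows≥ : ∀ {n} (x : Vec ℕ n) {M} → M ≤ n → ∀ s → count≥ s (take M (toList x)) ≡ rows≥ (at x) M s
count≥-take≡rows≥ x {zero} _ s = refl
count≥-take≡rows≥ (a ∷ xs) {suc M} (s≤s M≤n) s =
  trans (cong (⟦ s ≤ a ⟧ +_) (count≥-take≡rows≥ xs M≤n s)) (sym (rows≥-unfoldˡ (at (a ∷ xs)) M s))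

take-toList-saturates : ∀ {n} (x : Vec ℕ n) {M} → n ≤ M → take M (toList x) ≡ take n (toList x)
take-toList-saturates [] {zero} _ = refl
take-toList-saturates [] {suc M} _ = refl
take-toList-saturates (a ∷ xs) {suc M} (s≤s n≤M) = cong (a ∷_) (take-toList-saturates xs n≤M)

length-take-toList : ∀ {n} (x : Vec ℕ n) {M} → M ≤ n → length (take M (toList x)) ≡ M
length-take-toList x {zero} _ = refl
length-take-toList (a ∷ xs) {suc M} (s≤s M≤n) = cong suc (length-take-toList xs M≤n)

at-injective : ∀ {n} (x y : Vec ℕ n) → (∀ r → r < n → at x r ≡ at y r) → x ≡ y
at-injective [] [] _ = refl
at-injective (a ∷ xs) (b ∷ ys) x≐y = cong₂ _∷_ (x≐y 0 (s≤s z≤n)) (at-injective xs ys λ r r<n → x≐y (suc r) (s≤s r<n))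

at-fromℕ< : ∀ {n} (x : Vec ℕ n) {r} (r<n : r < n) → lookup x (fromℕ< r<n) ≡ at x r
at-fromℕ< x r<n = trans (lookup≡at x (fromℕ< r<n)) (cong (at x) (toℕ-fromℕ< r<n))

tabulateℕ : ∀ n → (ℕ → ℕ) → Vec ℕ n
tabulateℕ zero g = []
tabulateℕ (suc n) g = g 0 ∷ tabulateℕ n (g ∘′ suc)

at-tabulateℕ : ∀ n g r → r < n → at (tabulateℕ n g) r ≡ g r
at-tabulateℕ (suc n) g zero _ = refl
at-tabulateℕ (suc n) g (suc r) (s≤s r<n) = at-tabulateℕ n (g ∘′ suc) r r<n

at-[]≔-≡ : ∀ {n} (x : Vec ℕ n) f v → at (x [ f ]≔ v) (toℕ f) ≡ v
at-[]≔-≡ (a ∷ xs) fzero v = refl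
at-[]≔-≡ (a ∷ xs) (fsuc f) v = at-[]≔-≡ xs f v

at-[]≔-≢ : ∀ {n} (x : Vec ℕ n) f v {r} → r ≢ toℕ f → at (x [ f ]≔ v) r ≡ at x r
at-[]≔-≢ (a ∷ xs) fzero v {zero} r≢f = contradiction refl r≢f
at-[]≔-≢ (a ∷ xs) fzero v {suc r} _ = refl
at-[]≔-≢ (a ∷ xs) (fsuc f) v {zero} _ = refl
at-[]≔-≢ (a ∷ xs) (fsuc f) v {suc r} r≢f = at-[]≔-≢ xs f v (r≢f ∘′ cong suc)

at-[]≔ : ∀ {n} (x : Vec ℕ n) f v r → at (x [ f ]≔ v) r ≡ update (at x) (toℕ f) v r
at-[]≔ x f v r with r ≟ toℕ f
... | yes refl = at-[]≔-≡ x f v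
... | no r≢f = at-[]≔-≢ x f v r≢f

at-swap : ∀ {n} (x : Vec ℕ n) f g r → f ≢ g →
  at ((x [ f ]≔ lookup x g) [ g ]≔ lookup x f) r ≡ swap (at x) (toℕ f) (toℕ g) r
at-swap x f g r f≢g = cases (r ≟ toℕ f) (r ≟ toℕ g)
  where
  F≢G : toℕ f ≢ toℕ g
  F≢G = f≢g ∘′ toℕ-injective
  cases : Dec (r ≡ toℕ f) → Dec (r ≡ toℕ g) → at ((x [ f ]≔ lookup x g) [ g ]≔ lookup x f) r ≡ swap (at x) (toℕ f) (toℕ g) r
  cases (yes refl) _ = begin
    at ((x [ f ]≔ lookup x g) [ g ]≔ lookup x f) (toℕ f)  ≡⟨ at-[]≔-≢ (x [ f ]≔ lookup x g) g (lookup x f) F≢G ⟩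
    at (x [ f ]≔ lookup x g) (toℕ f)                       ≡⟨ at-[]≔-≡ x f _ ⟩
    lookup x g                                             ≡⟨ lookup≡at x g ⟩
    at x (toℕ g)                                           ≡⟨ swap-≡ˡ (at x) F≢G ⟨
    swap (at x) (toℕ f) (toℕ g) (toℕ f)                    ∎
    where open ≡-Reasoning
  cases (no _) (yes refl) = trans (at-[]≔-≡ (x [ f ]≔ lookup x g) g (lookup x f)) (trans (lookup≡at x f) (sym (swap-≡ʳ (at x) (toℕ f) (toℕ g))))
  cases (no r≢f) (no r≢g) = trans (at-[]≔-≢ (x [ f ]≔ lookup x g) g (lookup x f) r≢g) (trans (at-[]≔-≢ x f (lookup x g) r≢f) (sym (swap-≢ (at x) r≢f r≢g)))

module _ {n : ℕ} where
  open Dominance n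

  count≥-sort-take : ∀ (x : Vec ℕ n) {M} → M ≤ n → ∀ s → count≥ s (sort (take M (toList x))) ≡ rows≥ (at x) M s
  count≥-sort-take x M≤n s = trans (sum-↭ (map⁺ ⟦ s ≤_⟧ (sort-↭ _))) (count≥-take≡rows≥ x M≤n s)

  ≼⇒⊑ : ∀ {x y : Vec ℕ n} → x ≼ y → at x ⊑ at y
  ≼⇒⊑ {x} {y} x≼y M M≤n s =
    subst₂ _≤_ (count≥-sort-take x M≤n s) (count≥-sort-take y M≤n s) (count≥-mono s (x≼y M))

  sorted-prefixes≤ : ∀ {x y : Vec ℕ n} → at x ⊑ at y → ∀ {M} → M ≤ n →
    Pointwise _≤_ (sort (take M (toList x))) (sort (take M (toList y)))
  sorted-prefixes≤ {x} {y} x⊑y {M} M≤n = count≥⇒pointwise (sorted _) (sorted _)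
    (begin
      length (sort (take M (toList x)))  ≡⟨ ↭-length (sort-↭ _) ⟩
      length (take M (toList x))         ≡⟨ length-take-toList x M≤n ⟩
      M                                  ≡⟨ length-take-toList y M≤n ⟨
      length (take M (toList y))         ≡⟨ ↭-length (sort-↭ _) ⟨
      length (sort (take M (toList y)))  ∎)
    (λ s → subst₂ _≤_ (sym (count≥-sort-take x M≤n s)) (sym (count≥-sort-take y M≤n s)) (x⊑y M M≤n s))
    where
    open ≡-Reasoning
    sorted : ∀ xs → AllPairs _≤_ (sort xs)
    sorted xs = Sorted⇒AllPairs ≤-totalOrder (sort-↗ xs)

  ⊑⇒≼ : ∀ {x y : Vec ℕ n} → at x ⊑ at y → x ≼ y
  ⊑⇒≼ {x} {y} x⊑y M with M ≤? n
  ... | yes M≤n = sorted-prefixes≤ x⊑y M≤n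
  ... | no M≰n = subst₂ (λ u v → Pointwise _≤_ (sort u) (sort v))
    (sym (take-toList-saturates x n≤M)) (sym (take-toList-saturates y n≤M)) (sorted-prefixes≤ x⊑y ≤-refl)
    where n≤M = <⇒≤ (≰⇒> M≰n)

  ≼-refl : ∀ {x : Vec ℕ n} → x ≼ x
  ≼-refl = ⊑⇒≼ ⊑-refl

  ≼-trans : ∀ {x y z : Vec ℕ n} → x ≼ y → y ≼ z → x ≼ z
  ≼-trans x≼y y≼z = ⊑⇒≼ (⊑-trans (≼⇒⊑ x≼y) (≼⇒⊑ y≼z))

  pair-chain : ∀ {P : Vec ℕ n → Set} {x y} → x ≼ y → x ≢ y → (∀ {z} → P z → z ≡ x ⊎ z ≡ y) → P x → P y →
    IsChainOfLength P 1
  pair-chain {P} {x} {y} x≼y x≢y classify Px Py =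
    total , x ∷ y ∷ [] , (x≢y ∷ []) ∷ [] ∷ [] , refl , λ z → member z , listed z
    where
    total : ∀ z z′ → P z → P z′ → z ≼ z′ ⊎ z′ ≼ z
    total z z′ Pz Pz′ with classify Pz | classify Pz′
    ... | inj₁ refl | inj₁ refl = inj₁ ≼-refl
    ... | inj₁ refl | inj₂ refl = inj₁ x≼y
    ... | inj₂ refl | inj₁ refl = inj₂ x≼y
    ... | inj₂ refl | inj₂ refl = inj₁ ≼-refl
    member : ∀ z → z ∈ x ∷ y ∷ [] → P z
    member z (here refl) = Px
    member z (there (here refl)) = Py
    listed : ∀ z → P z → z ∈ x ∷ y ∷ []
    listed z Pz = [ (λ { refl → here refl }) , (λ { refl → there (here refl) }) ]′ (classify Pz)

  image-chain : ∀ {P : Vec ℕ n → Set} (f : ℕ → Vec ℕ n) {vs L} → (∀ {v w} → v ≤ w → f v ≼ f w) →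
    (∀ {v w} → f v ≡ f w → v ≡ w) → Unique vs → length vs ≡ suc L →
    (∀ {v} → v ∈ vs → P (f v)) → (∀ {y} → P y → ∃ λ v → v ∈ vs × y ≡ f v) → IsChainOfLength P L
  image-chain {P} f {vs} mono f-injective unique length≡ into onto =
    total , map f vs , Unique.map⁺ f-injective unique , trans (length-map f vs) length≡ , λ y → member y , listed y
    where
    total : ∀ y z → P y → P z → y ≼ z ⊎ z ≼ y
    total y z Py Pz with onto Py | onto Pz
    ... | v , _ , refl | w , _ , refl = Data.Sum.map mono mono (≤-total v w)
    member : ∀ y → y ∈ map f vs → P y
    member y y∈ with ∈-map⁻ f y∈
    ... | v , v∈ , refl = into v∈
    listed : ∀ y → P y → y ∈ map f vs
    listed y Py with onto Py
    ... | v , v∈ , refl = ∈-map⁺ f v∈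

-- Placements and the greedy maximum

module Board (n : ℕ) (L : ℕ → ℕ) (L-mono : ∀ {r q} → r ≤ q → q < n → L r ≤ L q) where
  open Dominance n

  record Placement (y : ℕ → ℕ) : Set where
    field
      positive : ∀ {r} → r < n → 1 ≤ y r
      bounded : ∀ {r} → r < n → y r ≤ L r
      injective : InjectiveBelow y n

  open Placement

  Placement-resp-≐ : ∀ {y z} → y ≐ z → Placement y → Placement z
  Placement-resp-≐ {y} {z} y≐z y-pl = record
    { positive = λ r<n → subst (1 ≤_) (y≐z _ r<n) (positive y-pl r<n)
    ; bounded = λ {r} r<n → subst (_≤ L r) (y≐z _ r<n) (bounded y-pl r<n)
    ; injective = λ q<n r<n zq≡zr → injective y-pl q<n r<n (trans (y≐z _ q<n) (trans zq≡zr (sym (y≐z _ r<n))))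
    }

  update-placement : ∀ {h m v} → Placement h → 1 ≤ v → v ≤ L m → (∀ {q} → q < n → q ≢ m → h q ≢ v) →
    Placement (update h m v)
  update-placement {h} {m} {v} h-pl 1≤v v≤Lm fresh = record
    { positive = λ {r} r<n → at-row r<n (1 ≤_) (λ _ → 1≤v) (positive h-pl r<n)
    ; bounded = λ {r} r<n → at-row r<n (_≤ L r) (λ { refl → v≤Lm }) (bounded h-pl r<n)
    ; injective = update-injective (injective h-pl) fresh
    }
    where
    at-row : ∀ {r} → r < n → (P : ℕ → Set) → (r ≡ m → P v) → P (h r) → P (update h m v r)
    at-row {r} r<n P Pv Phr with r ≟ m
    ... | yes r≡m = Pv r≡m
    ... | no _ = Phr

  swap-placement : ∀ {h m k} → Placement h → m < k → k < n → h k ≤ L m → Placement (swap h m k)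
  swap-placement {h} {m} {k} h-pl m<k k<n hk≤Lm = record
    { positive = λ {r} r<n → subst (1 ≤_) (sym (swap≡∘transpose h m≢k r)) (positive h-pl (transpose-< m<n k<n r<n))
    ; bounded = λ {r} r<n → bounded-at r<n (r ≟ m) (r ≟ k)
    ; injective = swap-injective m<n k<n m≢k (injective h-pl)
    }
    where
    m≢k = <⇒≢ m<k
    m<n = <-trans m<k k<n
    bounded-at : ∀ {r} → r < n → Dec (r ≡ m) → Dec (r ≡ k) → swap h m k r ≤ L r
    bounded-at r<n (yes refl) _ = subst (_≤ L _) (sym (swap-≡ˡ h m≢k)) hk≤Lm
    bounded-at r<n (no _) (yes refl) = subst (_≤ L _) (sym (swap-≡ʳ h m k)) (≤-trans (bounded h-pl m<n) (L-mono (<⇒≤ m<k) k<n))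
    bounded-at r<n (no r≢m) (no r≢k) = subst (_≤ L _) (sym (swap-≢ h r≢m r≢k)) (bounded h-pl r<n)

  placement-<1+L : ∀ {y} → Placement y → ∀ {M q} → M < n → q < suc M → y q < suc (L M)
  placement-<1+L y-pl M<n q<1+M = s≤s (≤-trans (bounded y-pl (≤-<-trans (≤-pred q<1+M) M<n)) (L-mono (≤-pred q<1+M) M<n))

  injective-below : ∀ {y} → Placement y → ∀ {M} → M ≤ n → InjectiveBelow y M
  injective-below y-pl M≤n q<M r<M = injective y-pl (<-≤-trans q<M M≤n) (<-≤-trans r<M M≤n)

  rows≥≡countBelow-values : ∀ {y} → Placement y → ∀ {M} → M < n → ∀ s →
    rows≥ y (suc M) s ≡ countBelow (λ w → s ≤? w ×-dec usedBelow? y (suc M) w) (suc (L M))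
  rows≥≡countBelow-values y-pl M<n s = rows≥≡countBelow-used _ s (injective-below y-pl M<n) (placement-<1+L y-pl M<n)

  module Greedy (t : ℕ → ℕ) (t-placement : Placement t)
    (saturated : ∀ {r w} → r < n → t r < w → w ≤ L r → UsedBelow t r w) where

    -- For s > t M every value in s, …, L M is taken by t in its first M + 1 rows, so y cannot take more.
    placement-⊑-greedy : ∀ {y} → Placement y → y ⊑ t
    placement-⊑-greedy {y} y-pl zero _ s = z≤n
    placement-⊑-greedy {y} y-pl (suc M) M<n s with s ≤? t M
    ... | yes s≤tM = subst (rows≥ y (suc M) s ≤_) (cong (rows≥ t M s +_) (sym (≤⇒⟦≤⟧≡1 s≤tM)))
          (+-mono-≤ (placement-⊑-greedy y-pl M (<⇒≤ M<n) s) (⟦≤⟧≤1 s (y M)))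
    ... | no s≰tM = begin
      rows≥ y (suc M) s
        ≡⟨ rows≥≡countBelow-values y-pl M<n s ⟩
      countBelow (λ w → s ≤? w ×-dec usedBelow? y (suc M) w) (suc (L M))
        ≤⟨ countBelow-mono (λ w → s ≤? w ×-dec usedBelow? y (suc M) w) (s ≤?_) (suc (L M)) (λ _ → proj₁) ⟩
      countBelow (s ≤?_) (suc (L M))
        ≤⟨ countBelow-mono (s ≤?_) (λ w → s ≤? w ×-dec usedBelow? t (suc M) w) (suc (L M)) (λ w<1+LM s≤w →
             s≤w , UsedBelow-mono (n≤1+n M) (saturated M<n (<-≤-trans (≰⇒> s≰tM) s≤w) (≤-pred w<1+LM))) ⟩
      countBelow (λ w → s ≤? w ×-dec usedBelow? t (suc M) w) (suc (L M))
        ≡⟨ rows≥≡countBelow-values t-placement M<n s ⟨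
      rows≥ t (suc M) s ∎
      where open ≤-Reasoning

    first-difference-< : ∀ {y m} → y ⊑ t → m < n → FirstDifference y t m → y m < t m
    first-difference-< {y} {m} y⊑t m<n diff = ≤∧≢⇒< (1≤⟦≤⟧⇒≤ (+-cancelˡ-≤ (rows≥ t m (y m)) _ _ (begin
      rows≥ t m (y m) + 1                 ≡⟨ cong₂ _+_ (rows≥-cong-below agrees (y m)) (≤⇒⟦≤⟧≡1 {y m} ≤-refl) ⟨
      rows≥ y (suc m) (y m)               ≤⟨ y⊑t (suc m) m<n (y m) ⟩
      rows≥ t m (y m) + ⟦ y m ≤ t m ⟧     ∎))) differs
      where
      open FirstDifference diff
      open ≤-Reasoning

    -- A switch on the rooks of t in rows m < k; gap and between say that the rectangle they span is empty.
    record SwitchAt (m k : ℕ) : Set where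
      field
        m<k : m < k
        k<n : k < n
        tk<tm : t k < t m
        gap : ∀ {w} → t k < w → w < t m → UsedBelow t m w
        between : ∀ {r} → m < r → r < k → t m < t r

      m<n : m < n
      m<n = <-trans m<k k<n

    record PushAt (m c : ℕ) : Set where
      field
        m<n : m < n
        1≤c : 1 ≤ c
        c<tm : c < t m
        vacant : ∀ {q} → q < n → t q ≢ c
        gap : ∀ {w} → c < w → w < t m → UsedBelow t m w
        above : ∀ {r} → m < r → r < n → t m < t r

    module _ {m k} (sw : SwitchAt m k) where
      open SwitchAt sw

      switch-placement : Placement (swap t m k)
      switch-placement = swap-placement t-placement m<k k<n (≤-trans (<⇒≤ tk<tm) (bounded t-placement m<n))

      switch-⊑ : swap t m k ⊑ t
      switch-⊑ = swap-⊑ t m<k (<⇒≤ tk<tm)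

      switch-first-difference : FirstDifference (swap t m k) t m
      switch-first-difference = record
        { agrees = λ q<m → swap-≢ t (<⇒≢ q<m) (<⇒≢ (<-trans q<m m<k))
        ; differs = λ eq → <⇒≢ tk<tm (trans (sym (swap-≡ˡ t (<⇒≢ m<k))) eq)
        }

    module _ {m c} (pu : PushAt m c) where
      open PushAt pu

      push-placement : Placement (update t m c)
      push-placement = update-placement t-placement 1≤c (≤-trans (<⇒≤ c<tm) (bounded t-placement m<n)) (λ q<n _ → vacant q<n)

      push-⊑ : update t m c ⊑ t
      push-⊑ = update-⊑ t m (<⇒≤ c<tm)

      push-first-difference : FirstDifference (update t m c) t m
      push-first-difference = record
        { agrees = λ q<m → update-≢ t c (<⇒≢ q<m)
        ; differs = λ eq → <⇒≢ c<tm (trans (sym (update-≡ t m c)) eq)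
        }

    -- A placement z squeezed between a move f of t and t itself agrees with t wherever f does.
    module Squeeze {f z m k a b} (f-off : ∀ {M s} → M ≤ n → OffWindow m k a b M s → rows≥ f M s ≡ rows≥ t M s)
      (f⊑z : f ⊑ z) (z⊑t : z ⊑ t) where

      rows≥-off : ∀ {M s} → M ≤ n → OffWindow m k a b M s → rows≥ z M s ≡ rows≥ t M s
      rows≥-off {M} {s} M≤n off = ≤-antisym (z⊑t M M≤n s) (subst (_≤ rows≥ z M s) (f-off M≤n off) (f⊑z M M≤n s))

      ⟦≤⟧-off : ∀ {r s} → r < n → OffWindow m k a b r s → OffWindow m k a b (suc r) s → ⟦ s ≤ z r ⟧ ≡ ⟦ s ≤ t r ⟧
      ⟦≤⟧-off {r} {s} r<n off off′ = ⟦≤⟧-row z t r s (rows≥-off (<⇒≤ r<n) off) (rows≥-off r<n off′)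

      row-fixed : ∀ {r} → r < n → r < m ⊎ k < r ⊎ b < t r → z r ≡ t r
      row-fixed {r} r<n r-off = ⟦≤⟧-≡⇒≡ (⟦≤⟧-off r<n (off ≤-refl) (off′ ≤-refl)) (⟦≤⟧-off r<n (off (n≤1+n _)) (off′ (n≤1+n _)))
        where
        off : ∀ {s} → t r ≤ s → OffWindow m k a b r s
        off tr≤s = [ rows-before ∘′ <⇒≤ , [ rows-after , (λ b<tr → values-above (<-≤-trans b<tr tr≤s)) ]′ ]′ r-off
        off′ : ∀ {s} → t r ≤ s → OffWindow m k a b (suc r) s
        off′ tr≤s = [ rows-before , [ rows-after ∘′ m<n⇒m<1+n , (λ b<tr → values-above (<-≤-trans b<tr tr≤s)) ]′ ]′ r-off

      row-bounded : ∀ {r} → r < n → a ≤ t r → t r ≤ b → a ≤ z r × z r ≤ b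
      row-bounded r<n a≤tr tr≤b =
        ⟦≤⟧-≡⇒≥ (⟦≤⟧-off r<n (values-below ≤-refl) (values-below ≤-refl)) a≤tr ,
        ⟦≤⟧-≡⇒≤ (⟦≤⟧-off r<n (values-above ≤-refl) (values-above ≤-refl)) tr≤b

    ¬UsedBelow-agreeing : ∀ {z m r} → Placement z → (∀ {q} → q < m → z q ≡ t q) → m ≤ r → r < n → ¬ UsedBelow t m (z r)
    ¬UsedBelow-agreeing z-pl agree m≤r r<n (q , q<m , tq≡zr) =
      <⇒≢ (<-≤-trans q<m m≤r) (injective z-pl (<-trans (<-≤-trans q<m m≤r) r<n) r<n (trans (agree q<m) tq≡zr))

    module _ {m k} (sw : SwitchAt m k) where
      open SwitchAt sw

      switch-covered : ∀ {z} → Placement z → swap t m k ⊑ z → z ⊑ t → z ≐ swap t m k ⊎ z ≐ t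
      switch-covered {z} z-pl sw⊑z z⊑t = classify (extreme m<n ≤-refl (<⇒≤ tk<tm) ≤-refl) (extreme k<n (<⇒≤ m<k) ≤-refl (<⇒≤ tk<tm))
        where
        open Squeeze (λ _ → rows≥-swap-off t m<k (<⇒≤ tk<tm)) sw⊑z z⊑t
        fixed : ∀ {r} → r < n → r ≢ m → r ≢ k → z r ≡ t r
        fixed {r} r<n r≢m r≢k with <-cmp r m | <-cmp r k
        ... | tri< r<m _ _ | _ = row-fixed r<n (inj₁ r<m)
        ... | tri≈ _ r≡m _ | _ = contradiction r≡m r≢m
        ... | tri> _ _ m<r | tri< r<k _ _ = row-fixed r<n (inj₂ (inj₂ (between m<r r<k)))
        ... | tri> _ _ _ | tri≈ _ r≡k _ = contradiction r≡k r≢k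
        ... | tri> _ _ _ | tri> _ _ k<r = row-fixed r<n (inj₂ (inj₁ k<r))
        extreme : ∀ {r} → r < n → m ≤ r → t k ≤ t r → t r ≤ t m → z r ≡ t k ⊎ z r ≡ t m
        extreme r<n m≤r tk≤tr tr≤tm with row-bounded r<n tk≤tr tr≤tm
        ... | tk≤zr , zr≤tm = ≤∧≤∧¬<<⇒≡∨≡ tk≤zr zr≤tm λ (tk<zr , zr<tm) →
          ¬UsedBelow-agreeing z-pl (λ q<m → row-fixed (<-trans q<m m<n) (inj₁ q<m)) m≤r r<n (gap tk<zr zr<tm)
        z-equal : z m ≡ z k → ∀ {A : Set} → A
        z-equal zm≡zk = contradiction (injective z-pl m<n k<n zm≡zk) (<⇒≢ m<k)
        classify : z m ≡ t k ⊎ z m ≡ t m → z k ≡ t k ⊎ z k ≡ t m → z ≐ swap t m k ⊎ z ≐ t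
        classify (inj₁ zm≡tk) (inj₂ zk≡tm) = inj₁ (≐-except₂ (trans zm≡tk (sym (swap-≡ˡ t (<⇒≢ m<k)))) (trans zk≡tm (sym (swap-≡ʳ t m k)))
          λ r<n r≢m r≢k → trans (fixed r<n r≢m r≢k) (sym (swap-≢ t r≢m r≢k)))
        classify (inj₂ zm≡tm) (inj₁ zk≡tk) = inj₂ (≐-except₂ zm≡tm zk≡tk fixed)
        classify (inj₁ zm≡tk) (inj₁ zk≡tk) = z-equal (trans zm≡tk (sym zk≡tk))
        classify (inj₂ zm≡tm) (inj₂ zk≡tm) = z-equal (trans zm≡tm (sym zk≡tm))

    module _ {m c} (pu : PushAt m c) where
      open PushAt pu

      update-squeezed : ∀ {v z} → v ≤ t m → Placement z → update t m v ⊑ z → z ⊑ t →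
        z ≐ update t m (z m) × v ≤ z m × (z m ≤ c ⊎ z m ≡ t m)
      update-squeezed {v} {z} v≤tm z-pl u⊑z z⊑t =
        ≐-except (sym (update-≡ t m (z m))) (λ r<n r≢m → trans (fixed r<n r≢m) (sym (update-≢ t (z m) r≢m))) ,
        proj₁ bounds , position
        where
        open Squeeze (λ M≤n → rows≥-update-off t {m} {n} v≤tm M≤n) u⊑z z⊑t
        fixed : ∀ {r} → r < n → r ≢ m → z r ≡ t r
        fixed {r} r<n r≢m with <-cmp r m
        ... | tri< r<m _ _ = row-fixed r<n (inj₁ r<m)
        ... | tri≈ _ r≡m _ = contradiction r≡m r≢m
        ... | tri> _ _ m<r = row-fixed r<n (inj₂ (inj₂ (above m<r r<n)))
        bounds : v ≤ z m × z m ≤ t m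
        bounds = row-bounded m<n v≤tm ≤-refl
        position : z m ≤ c ⊎ z m ≡ t m
        position with c <? z m | z m ≟ t m
        ... | no c≮zm | _ = inj₁ (≮⇒≥ c≮zm)
        ... | yes _ | yes zm≡tm = inj₂ zm≡tm
        ... | yes c<zm | no zm≢tm = contradiction (gap c<zm (≤∧≢⇒< (proj₂ bounds) zm≢tm))
              (¬UsedBelow-agreeing z-pl (λ q<m → fixed (<-trans q<m m<n) (<⇒≢ q<m)) ≤-refl m<n)

      push-covered : ∀ {z} → Placement z → update t m c ⊑ z → z ⊑ t → z ≐ update t m c ⊎ z ≐ t
      push-covered {z} z-pl pu⊑z z⊑t with update-squeezed (<⇒≤ c<tm) z-pl pu⊑z z⊑t
      ... | z≐ , c≤zm , inj₁ zm≤c = inj₁ (subst (λ v → z ≐ update t m v) (≤-antisym zm≤c c≤zm) z≐)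
      ... | z≐ , _ , inj₂ zm≡tm = inj₂ (≐-trans (subst (λ v → z ≐ update t m v) zm≡tm z≐) (update-self t m))

    ⊑-switch : ∀ {y m k} → SwitchAt m k → Placement y → (∀ {q} → q < m → y q ≡ t q) → y m ≤ t k → y ⊑ swap t m k
    ⊑-switch sw y-pl agree ym≤tk = ⊑-confined-move (placement-⊑-greedy y-pl) agree ym≤tk between
      (λ _ → rows≥-swap-off t m<k (<⇒≤ tk<tm)) (rows≥-swap-in t)
      where open SwitchAt sw

    ⊑-push : ∀ {y m c} → PushAt m c → Placement y → (∀ {q} → q < m → y q ≡ t q) → y m ≤ c → y ⊑ update t m c
    ⊑-push pu y-pl agree ym≤c = ⊑-confined-move (placement-⊑-greedy y-pl) agree ym≤c (λ m<r r<n → above m<r r<n)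
      (λ M≤n → rows≥-update-off t (<⇒≤ c<tm) M≤n) (rows≥-update-in t)
      where open PushAt pu

    -- The values strictly between c and t m are taken below row m, so a later row with a value below t m
    -- would hold c or, by saturation, force c to be taken before it.
    above-gap : ∀ {m c r} → c < t m → (∀ {w} → c < w → w < t m → UsedBelow t m w) →
      m < r → r < n → t r ≢ c → ¬ UsedBelow t r c → t m < t r
    above-gap {m} {c} {r} c<tm gap m<r r<n tr≢c c-free with <-cmp (t r) (t m)
    ... | tri> _ _ tm<tr = tm<tr
    ... | tri≈ _ tr≡tm _ = contradiction (injective t-placement r<n (<-trans m<r r<n) tr≡tm) (<⇒≢ m<r ∘′ sym)
    ... | tri< tr<tm _ _ with c <? t r
    ...   | yes c<tr = let (q , q<m , tq≡tr) = gap c<tr tr<tm in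
            contradiction (injective t-placement (<-trans (<-trans q<m m<r) r<n) r<n tq≡tr) (<⇒≢ (<-trans q<m m<r))
    ...   | no c≮tr = contradiction (saturated r<n (≤∧≢⇒< (≮⇒≥ c≮tr) tr≢c)
              (≤-trans (<⇒≤ c<tm) (≤-trans (bounded t-placement (<-trans m<r r<n)) (L-mono (<⇒≤ m<r) r<n)))) c-free

    -- The coatom's new value c at row m is the largest value in [y m, t m) not taken below row m;
    -- whether some later row of t holds c decides between a switch and a push.
    below-switch-or-push : ∀ {y m} → Placement y → m < n → FirstDifference y t m →
      (∃ λ k → SwitchAt m k × y ⊑ swap t m k) ⊎ (∃ λ c → PushAt m c × y ⊑ update t m c)
    below-switch-or-push {y} {m} y-pl m<n diff
      with greatest-unused-< (first-difference-< (placement-⊑-greedy y-pl) m<n diff) (¬UsedBelow-agreeing y-pl agrees ≤-refl m<n)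
      where open FirstDifference diff
    ... | c , ym≤c , c<tm , c-free , gap with usedBelow? t n c
    ...   | no c-vacant = inj₂ (c , pu , ⊑-push pu y-pl (FirstDifference.agrees diff) ym≤c)
      where
      vacant : ∀ {q} → q < n → t q ≢ c
      vacant q<n tq≡c = c-vacant (_ , q<n , tq≡c)
      pu : PushAt m c
      pu = record
        { m<n = m<n ; 1≤c = ≤-trans (positive y-pl m<n) ym≤c ; c<tm = c<tm ; vacant = vacant ; gap = gap
        ; above = λ m<r r<n → above-gap c<tm gap m<r r<n (vacant r<n) (λ (q , q<r , tq≡c) → vacant (<-trans q<r r<n) tq≡c) }
    ...   | yes (k , k<n , tk≡c) with <-cmp k m
    ...     | tri< k<m _ _ = contradiction (k , k<m , tk≡c) c-free
    ...     | tri≈ _ refl _ = contradiction tk≡c (<⇒≢ c<tm ∘′ sym)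
    ...     | tri> _ _ m<k = inj₁ (k , sw , ⊑-switch sw y-pl (FirstDifference.agrees diff) (subst (y m ≤_) (sym tk≡c) ym≤c))
      where
      k-only : ∀ {r} → r < n → t r ≡ c → r ≡ k
      k-only r<n tr≡c = injective t-placement r<n k<n (trans tr≡c (sym tk≡c))
      sw : SwitchAt m k
      sw = record
        { m<k = m<k ; k<n = k<n ; tk<tm = subst (_< t m) (sym tk≡c) c<tm
        ; gap = λ tk<w w<tm → gap (subst (_< _) tk≡c tk<w) w<tm
        ; between = λ m<r r<k → above-gap c<tm gap m<r (<-trans r<k k<n)
            (λ tr≡c → <⇒≢ r<k (k-only (<-trans r<k k<n) tr≡c))
            (λ (q , q<r , tq≡c) → <⇒≢ (<-trans q<r r<k) (k-only (<-trans (<-trans q<r r<k) k<n) tq≡c)) }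

    Pinned : (ℕ → ℕ) → ℕ → Set
    Pinned y m = ∀ {z r} → Placement z → y ⊑ z → r < n → FirstDifference z t r → r ≡ m

    pinned-agree : ∀ {y z m} → Pinned y m → Placement z → y ⊑ z → (∀ {q} → q ≤ m → z q ≡ t q) → z ≐ t
    pinned-agree {z = z} pinned z-pl y⊑z agree with firstDifference? z t n
    ... | inj₁ z≐t = z≐t
    ... | inj₂ (r , r<n , diff) with pinned z-pl y⊑z r<n diff
    ...   | refl = contradiction (agree ≤-refl) (FirstDifference.differs diff)

    -- Raising y m back to t m (directly, or by exchanging it with the row holding t m) gives a placement
    -- above y agreeing with t through row m, hence equal to t.
    pinned-shape : ∀ {y m} → Placement y → Pinned y m → m < n →
      y ≐ update t m (y m) ⊎ (∃ λ r → m < r × r < n × t r < t m × y ≐ swap t m r)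
    pinned-shape {y} {m} y-pl pinned m<n with firstDifference? y t n
    ... | inj₁ y≐t = inj₁ (≐-update λ r<n _ → y≐t _ r<n)
    ... | inj₂ (m′ , m′<n , diff′) with pinned y-pl ⊑-refl m′<n diff′
    ...   | refl with usedBelow? y n (t m)
    ...     | no tm-free = inj₁ (≐-update λ {r} r<n r≢m → trans (sym (update-≢ y (t m) r≢m)) (raised≐t r r<n))
      where
      open FirstDifference diff′
      raised≐t : update y m (t m) ≐ t
      raised≐t = pinned-agree pinned
        (update-placement y-pl (positive t-placement m<n) (bounded t-placement m<n) (λ q<n _ yq≡tm → tm-free (_ , q<n , yq≡tm)))
        (⊑-update y m (<⇒≤ (first-difference-< (placement-⊑-greedy y-pl) m<n diff′)))
        λ {q} q≤m → [ (λ q<m → trans (update-≢ y (t m) (<⇒≢ q<m)) (agrees q<m)) , (λ { refl → update-≡ y q (t q) }) ]′ (m≤n⇒m<n∨m≡n q≤m)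
    ...     | yes (r , r<n , yr≡tm) with <-cmp r m
    ...       | tri< r<m _ _ = contradiction (injective t-placement (<-trans r<m m<n) m<n (trans (sym (FirstDifference.agrees diff′ r<m)) yr≡tm)) (<⇒≢ r<m)
    ...       | tri≈ _ refl _ = contradiction yr≡tm (FirstDifference.differs diff′)
    ...       | tri> _ _ m<r = inj₂ (r , m<r , r<n , tr<tm , y≐swap)
      where
      open FirstDifference diff′
      ym<tm : y m < t m
      ym<tm = first-difference-< (placement-⊑-greedy y-pl) m<n diff′
      exchanged≐t : swap y m r ≐ t
      exchanged≐t = pinned-agree pinned
        (swap-placement y-pl m<r r<n (subst (_≤ L m) (sym yr≡tm) (bounded t-placement m<n)))
        (⊑-swap y m<r (<⇒≤ (subst (y m <_) (sym yr≡tm) ym<tm)))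
        λ {q} q≤m → [ (λ q<m → trans (swap-≢ y (<⇒≢ q<m) (<⇒≢ (<-trans q<m m<r))) (agrees q<m))
                    , (λ { refl → trans (swap-≡ˡ y (<⇒≢ m<r)) yr≡tm }) ]′ (m≤n⇒m<n∨m≡n q≤m)
      tr≡ym : t r ≡ y m
      tr≡ym = trans (sym (exchanged≐t r r<n)) (swap-≡ʳ y m r)
      tr<tm : t r < t m
      tr<tm = subst (_< t m) (sym tr≡ym) ym<tm
      y≐swap : y ≐ swap t m r
      y≐swap = ≐-except₂ (trans (sym tr≡ym) (sym (swap-≡ˡ t (<⇒≢ m<r)))) (trans yr≡tm (sym (swap-≡ʳ t m r)))
        λ r′<n r′≢m r′≢r → trans (sym (swap-≢ y r′≢m r′≢r)) (trans (exchanged≐t _ r′<n) (sym (swap-≢ t r′≢m r′≢r)))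

    pinned-push : ∀ {y m c} → PushAt m c → Placement y → Pinned y m → y ≐ update t m (y m)
    pinned-push pu y-pl pinned with pinned-shape y-pl pinned (PushAt.m<n pu)
    ... | inj₁ y≐update = y≐update
    ... | inj₂ (r , m<r , r<n , tr<tm , _) = contradiction (PushAt.above pu m<r r<n) (<-asym tr<tm)

    -- Moving the lowered value y m to row k instead gives a placement above y first differing from t at k.
    pinned-lowered⇒greedy : ∀ {y m k} → SwitchAt m k → Placement y → Pinned y m → y ≐ update t m (y m) → y m ≡ t m
    pinned-lowered⇒greedy {y} {m} {k} sw y-pl pinned y≐update with y m ≟ t m
    ... | yes ym≡tm = ym≡tm
    ... | no ym≢tm = contradiction (pinned lowered-k-placement (⊑-trans y⊑update lowered-k⊑) k<n lowered-k-differs) (<⇒≢ m<k ∘′ sym)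
      where
      open SwitchAt sw
      y-agrees : ∀ {r} → r < n → r ≢ m → y r ≡ t r
      y-agrees r<n r≢m = trans (y≐update _ r<n) (update-≢ t (y m) r≢m)
      ym<tm : y m < t m
      ym<tm = first-difference-< (placement-⊑-greedy y-pl) m<n
        record { agrees = λ q<m → y-agrees (<-trans q<m m<n) (<⇒≢ q<m) ; differs = ym≢tm }
      lowered-k-placement : Placement (update t k (y m))
      lowered-k-placement = update-placement t-placement (positive y-pl m<n)
        (≤-trans (bounded y-pl m<n) (L-mono (<⇒≤ m<k) k<n))
        λ {q} q<n _ tq≡ym → case q ≟ m of λ where
          (yes refl) → ym≢tm (sym tq≡ym)
          (no q≢m) → q≢m (injective y-pl q<n m<n (trans (y-agrees q<n q≢m) tq≡ym))
      y⊑update : y ⊑ update t m (y m)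
      y⊑update = ⊑-resp-≐ (≐-sym y≐update) ≐-refl ⊑-refl
      lowered-k⊑ : update t m (y m) ⊑ update t k (y m)
      lowered-k⊑ = update-⊑-update t m<k (<⇒≤ ym<tm) (<⇒≤ tk<tm)
      lowered-k-differs : FirstDifference (update t k (y m)) t k
      lowered-k-differs = record
        { agrees = λ q<k → update-≢ t (y m) (<⇒≢ q<k)
        ; differs = λ ym≡tk → <⇒≢ m<k (injective y-pl m<n k<n
            (trans (sym (update-≡ t k (y m))) (trans ym≡tk (sym (y-agrees k<n (<⇒≢ m<k ∘′ sym)))))) }

    -- Exchanging rows m < r of t is ruled out between m and k by the switch conditions, and beyond k
    -- because exchanging rows k and r instead gives a placement above y first differing from t at k.
    pinned-exchanged⇒partner : ∀ {y m k r} → SwitchAt m k → Pinned y m → m < r → r < n → t r < t m →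
      y ≐ swap t m r → r ≡ k
    pinned-exchanged⇒partner {y} {m} {k} {r} sw pinned m<r r<n tr<tm y≐swap with <-cmp r k
    ... | tri≈ _ r≡k _ = r≡k
    ... | tri< r<k _ _ = contradiction (SwitchAt.between sw m<r r<k) (<-asym tr<tm)
    ... | tri> _ _ k<r = contradiction (pinned exchanged-k-placement (⊑-trans y⊑swap exchanged-k⊑) k<n exchanged-k-differs) (<⇒≢ m<k ∘′ sym)
      where
      open SwitchAt sw
      exchanged-k-placement : Placement (swap t k r)
      exchanged-k-placement = swap-placement t-placement k<r r<n
        (≤-trans (<⇒≤ tr<tm) (≤-trans (bounded t-placement m<n) (L-mono (<⇒≤ m<k) k<n)))
      y⊑swap : y ⊑ swap t m r
      y⊑swap = ⊑-resp-≐ (≐-sym y≐swap) ≐-refl ⊑-refl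
      exchanged-k⊑ : swap t m r ⊑ swap t k r
      exchanged-k⊑ = swap-⊑-swap t m<k k<r (<⇒≤ tr<tm) (<⇒≤ tk<tm)
      exchanged-k-differs : FirstDifference (swap t k r) t k
      exchanged-k-differs = record
        { agrees = λ q<k → swap-≢ t (<⇒≢ q<k) (<⇒≢ (<-trans q<k k<r))
        ; differs = λ tr≡tk → <⇒≢ k<r (sym (injective t-placement r<n k<n (trans (sym (swap-≡ˡ t (<⇒≢ k<r))) tr≡tk))) }

    pinned-switch : ∀ {y m k} → SwitchAt m k → Placement y → Pinned y m → y ≐ swap t m k ⊎ y ≐ t
    pinned-switch {y} {m} sw y-pl pinned with pinned-shape y-pl pinned (SwitchAt.m<n sw)
    ... | inj₁ y≐update = inj₂ (≐-trans y≐update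
            (subst (λ v → update t m v ≐ t) (sym (pinned-lowered⇒greedy sw y-pl pinned y≐update)) (update-self t m)))
    ... | inj₂ (r , m<r , r<n , tr<tm , y≐swap) with pinned-exchanged⇒partner sw pinned m<r r<n tr<tm y≐swap
    ...   | refl = inj₁ y≐swap

-- The greedy construction of 1̂

elemB-∷-true⁻ : ∀ {w a used} → elemB w (a ∷ used) ≡ true → w ≡ a ⊎ elemB w used ≡ true
elemB-∷-true⁻ {w} {a} eq with w ≡ᵇ a in w≡ᵇa
... | true = inj₁ (≡ᵇ⇒≡ w a (subst T (sym w≡ᵇa) tt))
... | false = inj₂ eq

elemB-∷-false⁻ : ∀ {w a used} → elemB w (a ∷ used) ≡ false → w ≢ a × elemB w used ≡ false
elemB-∷-false⁻ {w} {a} eq with w ≡ᵇ a in w≡ᵇa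
... | false = (λ { refl → subst T w≡ᵇa (≡⇒≡ᵇ w w refl) }) , eq

maxAvail-≤ : ∀ k used → maxAvail k used ≤ k
maxAvail-≤ zero used = z≤n
maxAvail-≤ (suc k) used with elemB (suc k) used
... | true = m≤n⇒m≤1+n (maxAvail-≤ k used)
... | false = ≤-refl

maxAvail-maximal : ∀ k used {w} → maxAvail k used < w → w ≤ k → elemB w used ≡ true
maxAvail-maximal zero used avail<w w≤0 = contradiction (≤-trans w≤0 z≤n) (<⇒≱ avail<w)
maxAvail-maximal (suc k) used {w} avail<w w≤1+k with elemB (suc k) used in taken
... | false = contradiction w≤1+k (<⇒≱ avail<w)
... | true with w ≟ suc k
...   | yes refl = taken
...   | no w≢1+k = maxAvail-maximal k used avail<w (≤-pred (≤∧≢⇒< w≤1+k w≢1+k))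

maxAvail-fresh : ∀ k used → maxAvail k used ≡ 0 ⊎ elemB (maxAvail k used) used ≡ false
maxAvail-fresh zero used = inj₁ refl
maxAvail-fresh (suc k) used with elemB (suc k) used in taken
... | true = maxAvail-fresh k used
... | false = inj₂ taken

UsedBelow-at-∷⁺ : ∀ {n a} {xs : Vec ℕ n} {r w} → UsedBelow (at xs) r w → UsedBelow (at (a ∷ xs)) (suc r) w
UsedBelow-at-∷⁺ (q , q<r , xq≡w) = suc q , s≤s q<r , xq≡w

UsedBelow-at-∷⁻ : ∀ {n a} {xs : Vec ℕ n} {r w} → UsedBelow (at (a ∷ xs)) (suc r) w → a ≡ w ⊎ UsedBelow (at xs) r w
UsedBelow-at-∷⁻ (zero , _ , a≡w) = inj₁ a≡w
UsedBelow-at-∷⁻ (suc q , s≤s q<r , xq≡w) = inj₂ (q , q<r , xq≡w)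

topFrom-fits : ∀ {n} (lam : Vec ℕ n) used {r} → r < n → at (topFrom lam used) r ≤ at lam r
topFrom-fits (l ∷ lam) used {zero} _ = maxAvail-≤ l used
topFrom-fits (l ∷ lam) used {suc r} (s≤s r<n) = topFrom-fits lam (maxAvail l used ∷ used) r<n

topFrom-saturated : ∀ {n} (lam : Vec ℕ n) used {r w} → r < n → at (topFrom lam used) r < w → w ≤ at lam r →
  UsedBelow (at (topFrom lam used)) r w ⊎ elemB w used ≡ true
topFrom-saturated (l ∷ lam) used {zero} _ avail<w w≤l = inj₂ (maxAvail-maximal l used avail<w w≤l)
topFrom-saturated (l ∷ lam) used {suc r} {w} (s≤s r<n) tr<w w≤Lr
  with topFrom-saturated lam (maxAvail l used ∷ used) r<n tr<w w≤Lr
... | inj₁ used-later = inj₁ (UsedBelow-at-∷⁺ used-later)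
... | inj₂ taken with elemB-∷-true⁻ {used = used} taken
...   | inj₁ w≡avail = inj₁ (zero , s≤s z≤n , sym w≡avail)
...   | inj₂ taken-before = inj₂ taken-before

topFrom-fresh : ∀ {n} (lam : Vec ℕ n) used {r} → r < n → let g = at (topFrom lam used) in
  g r ≡ 0 ⊎ (¬ UsedBelow g r (g r) × elemB (g r) used ≡ false)
topFrom-fresh (l ∷ lam) used {zero} _ = Data.Sum.map id (λ fresh → (λ ()) , fresh) (maxAvail-fresh l used)
topFrom-fresh (l ∷ lam) used {suc r} (s≤s r<n) with topFrom-fresh lam (maxAvail l used ∷ used) r<n
... | inj₁ tr≡0 = inj₁ tr≡0
... | inj₂ (unused , fresh) with elemB-∷-false⁻ {used = used} fresh
...   | tr≢avail , fresh-before = inj₂ ([ tr≢avail ∘′ sym , unused ]′ ∘′ UsedBelow-at-∷⁻ , fresh-before)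

-- The sets X_{c} for a fixed shape

module Shape {n} (lam : Vec ℕ n) (part : IsPartition lam) (rb : RowBound lam) where
  open Dominance n

  L t : ℕ → ℕ
  L = at lam
  t = at (top lam)

  L-mono : ∀ {r q} → r ≤ q → q < n → L r ≤ L q
  L-mono {r} {q} r≤q q<n = subst₂ _≤_ (at-fromℕ< lam r<n) (at-fromℕ< lam q<n)
    (part (fromℕ< r<n) (fromℕ< q<n) (subst₂ _≤_ (sym (toℕ-fromℕ< r<n)) (sym (toℕ-fromℕ< q<n)) r≤q))
    where r<n = ≤-<-trans r≤q q<n

  row<L : ∀ {r} → r < n → r < L r
  row<L {r} r<n = subst₂ (λ a b → suc a ≤ b) (toℕ-fromℕ< r<n) (at-fromℕ< lam r<n) (rb (fromℕ< r<n))

  t-saturated : ∀ {r w} → r < n → t r < w → w ≤ L r → UsedBelow t r w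
  t-saturated r<n tr<w w≤Lr with topFrom-saturated lam [] r<n tr<w w≤Lr
  ... | inj₁ used = used

  t-fresh : ∀ {r} → r < n → t r ≡ 0 ⊎ ¬ UsedBelow t r (t r)
  t-fresh r<n = Data.Sum.map id proj₁ (topFrom-fresh lam [] r<n)

  -- If t q were 0, every value in 1, …, L q would be taken by the q rows below row q, but L q > q.
  t-positive-below : ∀ {M} → M ≤ n → ∀ {q} → q < M → 1 ≤ t q
  t-positive-below {suc M} M<n {q} q<1+M with m<1+n⇒m<n∨m≡n q<1+M
  ... | inj₁ q<M = t-positive-below (<⇒≤ M<n) q<M
  ... | inj₂ refl with t q in tq≡
  ...   | suc _ = s≤s z≤n
  ...   | zero = contradiction (covering-values-≤-rows injective-below-q values-fit covered) (<⇒≱ (row<L M<n))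
    where
    injective-below-q : InjectiveBelow t q
    injective-below-q = fresh⇒injective λ {r} r<q →
      [ (λ tr≡0 → contradiction tr≡0 (<⇒≢ (t-positive-below (<⇒≤ M<n) r<q) ∘′ sym)) , id ]′ (t-fresh (<-trans r<q M<n))
    values-fit : ∀ {r} → r < q → t r ≤ L q
    values-fit r<q = ≤-trans (topFrom-fits lam [] (<-trans r<q M<n)) (L-mono (<⇒≤ r<q) M<n)
    covered : ∀ {w} → 1 ≤ w → w ≤ L q → UsedBelow t q w
    covered 1≤w w≤Lq = t-saturated M<n (subst (_< _) (sym tq≡) 1≤w) w≤Lq

  t-positive : ∀ {r} → r < n → 1 ≤ t r
  t-positive = t-positive-below ≤-refl

  open Board n L L-mono

  t-placement : Placement t
  t-placement = record
    { positive = t-positive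
    ; bounded = topFrom-fits lam []
    ; injective = fresh⇒injective λ r<n → [ (λ tr≡0 → contradiction tr≡0 (<⇒≢ (t-positive r<n) ∘′ sym)) , id ]′ (t-fresh r<n)
    }

  open Greedy t t-placement t-saturated

  IsPlacement⇒Placement : ∀ x → IsPlacement lam x → Placement (at x)
  IsPlacement⇒Placement x (bounds , distinct) = record
    { positive = λ r<n → subst (1 ≤_) (at-fromℕ< x r<n) (proj₁ (bounds (fromℕ< r<n)))
    ; bounded = λ r<n → subst₂ _≤_ (at-fromℕ< x r<n) (at-fromℕ< lam r<n) (proj₂ (bounds (fromℕ< r<n)))
    ; injective = λ q<n r<n xq≡xr → trans (sym (toℕ-fromℕ< q<n)) (trans (cong toℕ
        (distinct _ _ (trans (at-fromℕ< x q<n) (trans xq≡xr (sym (at-fromℕ< x r<n)))))) (toℕ-fromℕ< r<n))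
    }

  Placement⇒IsPlacement : ∀ x → Placement (at x) → IsPlacement lam x
  Placement⇒IsPlacement x x-pl =
    (λ f → subst (1 ≤_) (sym (lookup≡at x f)) (positive x-pl (toℕ<n f)) ,
           subst₂ _≤_ (sym (lookup≡at x f)) (sym (lookup≡at lam f)) (bounded x-pl (toℕ<n f))) ,
    (λ f g xf≡xg → toℕ-injective (injective x-pl (toℕ<n f) (toℕ<n g) (trans (sym (lookup≡at x f)) (trans xf≡xg (lookup≡at x g)))))
    where open Placement

  coatom : ∀ {c f m} → at c ≐ f → Placement f → f ⊑ t → m < n → FirstDifference f t m →
    (∀ {z} → Placement z → f ⊑ z → z ⊑ t → z ≐ f ⊎ z ≐ t) → Coatom lam c
  coatom {c} {f} {m} c≐f f-pl f⊑t m<n diff covered =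
    Placement⇒IsPlacement c (Placement-resp-≐ (≐-sym c≐f) f-pl) ,
    (λ c≡top → FirstDifference.differs diff (trans (sym (c≐f m m<n)) (cong (λ x → at x m) c≡top))) ,
    ⊑⇒≼ (⊑-resp-≐ (≐-sym c≐f) ≐-refl f⊑t) ,
    λ z z-pl c≼z z≼top → Data.Sum.map (λ z≐f → at-injective z c (≐-trans z≐f (≐-sym c≐f))) (at-injective z (top lam))
      (covered (IsPlacement⇒Placement z z-pl) (⊑-resp-≐ c≐f ≐-refl (≼⇒⊑ c≼z)) (≼⇒⊑ z≼top))

  switch-coatom : ∀ {c m k} → SwitchAt m k → at c ≐ swap t m k → Coatom lam c
  switch-coatom sw c≐ = coatom c≐ (switch-placement sw) (switch-⊑ sw) (SwitchAt.m<n sw) (switch-first-difference sw) (switch-covered sw)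

  push-coatom : ∀ {c m c′} → PushAt m c′ → at c ≐ update t m c′ → Coatom lam c
  push-coatom pu c≐ = coatom c≐ (push-placement pu) (push-⊑ pu) (PushAt.m<n pu) (push-first-difference pu) (push-covered pu)

  -- Whatever lies above y and differs from t sits below a coatom at the row of its first difference;
  -- for y ∈ X_{c} that coatom must be c itself.
  InX⇒Pinned : ∀ {c y m} → FirstDifference (at c) t m → InX lam c y → Pinned (at y) m
  InX⇒Pinned {c} {y} {m} c-diff (_ , avoids) {z} {r} z-pl y⊑z r<n z-diff =
    [ (λ (k , sw , z⊑) → through (switch-coatom sw (at-tabulateℕ n _)) (switch-first-difference sw) z⊑)
    , (λ (c′ , pu , z⊑) → through (push-coatom pu (at-tabulateℕ n _)) (push-first-difference pu) z⊑)
    ]′ (below-switch-or-push z-pl r<n z-diff)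
    where
    through : ∀ {f} → Coatom lam (tabulateℕ n f) → FirstDifference f t r → z ⊑ f → r ≡ m
    through {f} g-coatom f-diff z⊑f with Data.Vec.Properties.≡-dec _≟_ (tabulateℕ n f) c
    ... | yes refl = firstDifference-unique (FirstDifference-resp-≐ (≐-sym (at-tabulateℕ n f)) r<n f-diff) c-diff
    ... | no g≢c = contradiction (⊑⇒≼ (⊑-trans y⊑z (⊑-resp-≐ ≐-refl (≐-sym (at-tabulateℕ n f)) z⊑f))) (avoids _ g-coatom g≢c)

  at-top : ∀ f → lookup (top lam) f ≡ t (toℕ f)
  at-top = lookup≡at (top lam)

  switchMove⇒SwitchAt : ∀ {i c} → SwitchMove (top lam) i c → ∃ λ k → SwitchAt (toℕ i) k × at c ≐ swap t (toℕ i) k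
  switchMove⇒SwitchAt {i} {c} (k , i<k , tk<ti , rectangle-empty , c≡) = toℕ k , sw , c≐swap
    where
    I K : ℕ
    I = toℕ i
    K = toℕ k
    K<n : K < n
    K<n = toℕ<n k
    tK<tI : t K < t I
    tK<tI = subst₂ _<_ (at-top k) (at-top i) tk<ti
    outside-rectangle : ∀ {q} → I < q → q < K → ¬ (t K ≤ t q × t q ≤ t I)
    outside-rectangle {q} I<q q<K (tK≤tq , tq≤tI) = rectangle-empty (fromℕ< q<n)
      (λ q≡i → <⇒≢ I<q (trans (sym (cong toℕ q≡i)) (toℕ-fromℕ< q<n)))
      (λ q≡k → <⇒≢ q<K (trans (sym (toℕ-fromℕ< q<n)) (cong toℕ q≡k)))
      (subst (I ≤_) (sym (toℕ-fromℕ< q<n)) (<⇒≤ I<q)) (subst (_≤ K) (sym (toℕ-fromℕ< q<n)) (<⇒≤ q<K))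
      (subst₂ _≤_ (sym (at-top k)) (sym (at-fromℕ< (top lam) q<n)) tK≤tq ,
       subst₂ _≤_ (sym (at-fromℕ< (top lam) q<n)) (sym (at-top i)) tq≤tI)
      where q<n = <-trans q<K K<n
    gap : ∀ {w} → t K < w → w < t I → UsedBelow t I w
    gap {w} tK<w w<tI with t-saturated K<n tK<w
      (≤-trans (<⇒≤ w<tI) (≤-trans (topFrom-fits lam [] (toℕ<n i)) (L-mono (<⇒≤ i<k) K<n)))
    ... | q , q<K , tq≡w with <-cmp q I
    ...   | tri< q<I _ _ = q , q<I , tq≡w
    ...   | tri≈ _ refl _ = contradiction tq≡w (<⇒≢ w<tI ∘′ sym)
    ...   | tri> _ _ I<q = contradiction (subst (t K ≤_) (sym tq≡w) (<⇒≤ tK<w) , subst (_≤ t I) (sym tq≡w) (<⇒≤ w<tI)) (outside-rectangle I<q q<K)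
    only-K : ∀ {r} → r < n → t r ≡ t K → r ≡ K
    only-K r<n tr≡tK = injective t-placement r<n K<n tr≡tK
      where open Placement
    sw : SwitchAt I K
    sw = record
      { m<k = i<k ; k<n = K<n ; tk<tm = tK<tI ; gap = gap
      ; between = λ I<r r<K → above-gap tK<tI gap I<r (<-trans r<K K<n)
          (<⇒≢ r<K ∘′ only-K (<-trans r<K K<n))
          (λ (q , q<r , tq≡tK) → <⇒≢ (<-trans q<r r<K) (only-K (<-trans (<-trans q<r r<K) K<n) tq≡tK)) }
    c≐swap : at c ≐ swap t I K
    c≐swap r _ = trans (cong (λ x → at x r) c≡) (at-swap (top lam) i k r (λ { refl → <-irrefl refl i<k }))

  pushMove⇒PushAt : ∀ {i c} → PushMove (top lam) i c → ∃ λ c′ → PushAt (toℕ i) c′ × at c ≐ update t (toℕ i) c′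
  pushMove⇒PushAt {i} {c} (c′ , 1≤c′ , c′<ti , empty-column , pushed-over , c≡) = c′ , pu , c≐update
    where
    I : ℕ
    I = toℕ i
    c′<tI : c′ < t I
    c′<tI = subst (c′ <_) (at-top i) c′<ti
    vacant : ∀ {q} → q < n → t q ≢ c′
    vacant q<n tq≡c′ = empty-column (fromℕ< q<n) (trans (at-fromℕ< (top lam) q<n) tq≡c′)
    gap : ∀ {w} → c′ < w → w < t I → UsedBelow t I w
    gap {w} c′<w w<tI with pushed-over w c′<w (subst (w <_) (sym (at-top i)) w<tI)
    ... | q , q<i , tq≡w = toℕ q , q<i , trans (sym (at-top q)) tq≡w
    pu : PushAt I c′
    pu = record
      { m<n = toℕ<n i ; 1≤c = 1≤c′ ; c<tm = c′<tI ; vacant = vacant ; gap = gap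
      ; above = λ I<r r<n → above-gap c′<tI gap I<r r<n (vacant r<n) (λ (q , q<r , tq≡c′) → vacant (<-trans q<r r<n) tq≡c′) }
    c≐update : at c ≐ update t I c′
    c≐update r _ = trans (cong (λ x → at x r) c≡) (at-[]≔ (top lam) i c′ r)

  ∈X-above : ∀ {c y} → Coatom lam c → IsPlacement lam y → c ≼ y → InX lam c y
  ∈X-above (_ , _ , _ , c-covered) y-pl c≼y = y-pl , λ c″ (c″-pl , c″≢top , c″≼top , _) c″≢c y≼c″ →
    [ c″≢c , c″≢top ]′ (c-covered c″ c″-pl (≼-trans c≼y y≼c″) c″≼top)

  switch-chain : ∀ {c m k} → SwitchAt m k → at c ≐ swap t m k → IsChainOfLength (InX lam c) 1
  switch-chain {c} {m} sw c≐swap = pair-chain c≼top c≢top classify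
    (∈X-above c-coatom c-placement ≼-refl) (∈X-above c-coatom (Placement⇒IsPlacement (top lam) t-placement) c≼top)
    where
    m<n = SwitchAt.m<n sw
    c-coatom : Coatom lam c
    c-coatom = switch-coatom sw c≐swap
    c-placement = proj₁ c-coatom
    c≢top = proj₁ (proj₂ c-coatom)
    c≼top = proj₁ (proj₂ (proj₂ c-coatom))
    classify : ∀ {y} → InX lam c y → y ≡ c ⊎ y ≡ top lam
    classify {y} y∈X = Data.Sum.map (λ y≐swap → at-injective y c (≐-trans y≐swap (≐-sym c≐swap))) (at-injective y (top lam))
      (pinned-switch sw (IsPlacement⇒Placement y (proj₁ y∈X))
        (InX⇒Pinned (FirstDifference-resp-≐ (≐-sym c≐swap) m<n (switch-first-difference sw)) y∈X))

  raised : ℕ → ℕ → Vec ℕ n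
  raised m v = tabulateℕ n (update t m v)

  Admissible : ℕ → ℕ → Set
  Admissible m v = 1 ≤ v × ¬ UsedBelow t m v

  admissible? : ∀ m → Decidable (Admissible m)
  admissible? m v = 1 ≤? v ×-dec ¬? (usedBelow? t m v)

  -- The admissible values are the L m values 1, …, L m minus the m values taken below row m.
  count-admissible : ∀ {m} → m < n → countBelow (admissible? m) (suc (L m)) ≡ suc (L m ∸ suc m)
  count-admissible {m} m<n = begin
    countBelow (admissible? m) (suc (L m))                  ≡⟨ m+n∸m≡n m _ ⟨
    m + countBelow (admissible? m) (suc (L m)) ∸ m          ≡⟨ cong (λ x → x + countBelow (admissible? m) (suc (L m)) ∸ m) taken ⟨
    (countBelow (λ v → 1 ≤? v ×-dec usedBelow? t m v) (suc (L m)) + countBelow (admissible? m) (suc (L m))) ∸ m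
                                                            ≡⟨ cong (_∸ m) (countBelow-split (1 ≤?_) (usedBelow? t m) (suc (L m))) ⟩
    countBelow (1 ≤?_) (suc (L m)) ∸ m                      ≡⟨ cong (_∸ m) (countBelow-≥ 1 (suc (L m))) ⟩
    L m ∸ m                                                 ≡⟨ +-∸-assoc 1 (row<L m<n) ⟩
    suc (L m ∸ suc m)                                       ∎
    where
    open ≡-Reasoning
    open Placement t-placement
    taken : countBelow (λ v → 1 ≤? v ×-dec usedBelow? t m v) (suc (L m)) ≡ m
    taken = trans (sym (rows≥≡countBelow-used t 1 (injective-below t-placement (<⇒≤ m<n))
              (λ q<m → placement-<1+L t-placement m<n (m<n⇒m<1+n q<m))))
            (rows≥-all (λ q<m → positive (<-trans q<m m<n)))

  raised-∈X : ∀ {c m c′ v} → PushAt m c′ → at c ≐ update t m c′ → v ≤ L m → Admissible m v → InX lam c (raised m v)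
  raised-∈X {c} {m} {c′} {v} pu c≐update v≤Lm (1≤v , v-free) =
    Placement⇒IsPlacement (raised m v) (Placement-resp-≐ (≐-sym (at-tabulateℕ n _)) raised-placement) , avoids
    where
    open PushAt pu
    v≤tm : v ≤ t m
    v≤tm with t m <? v
    ... | yes tm<v = contradiction (t-saturated m<n tm<v v≤Lm) v-free
    ... | no tm≮v = ≮⇒≥ tm≮v
    raised-placement : Placement (update t m v)
    raised-placement = update-placement t-placement 1≤v v≤Lm λ {q} q<n q≢m tq≡v → case <-cmp q m of λ where
      (tri< q<m _ _) → v-free (q , q<m , tq≡v)
      (tri≈ _ q≡m _) → q≢m q≡m
      (tri> _ _ m<q) → <⇒≱ (above m<q q<n) (subst (_≤ t m) (sym tq≡v) v≤tm)
    c-coatom = push-coatom pu c≐update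
    avoids : ∀ c″ → Coatom lam c″ → c″ ≢ c → ¬ (raised m v ≼ c″)
    avoids c″ (c″-pl , c″≢top , c″≼top , c″-covered) c″≢c raised≼c″
      with update-squeezed pu v≤tm (IsPlacement⇒Placement c″ c″-pl)
             (⊑-resp-≐ (at-tabulateℕ n _) ≐-refl (≼⇒⊑ raised≼c″)) (≼⇒⊑ c″≼top)
    ... | c″≐ , _ , inj₁ c″m≤c′ = [ c″≢c ∘′ sym , proj₁ (proj₂ c-coatom) ]′
          (c″-covered c (proj₁ c-coatom) c″≼c (proj₁ (proj₂ (proj₂ c-coatom))))
      where
      c″≼c : c″ ≼ c
      c″≼c = ⊑⇒≼ (⊑-resp-≐ (≐-sym c″≐) (≐-sym c≐update) (update-mono t m {at c″ m} {c′} c″m≤c′))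
    ... | c″≐ , _ , inj₂ c″m≡tm = c″≢top (at-injective c″ (top lam)
          (≐-trans c″≐ (subst (λ x → update t m x ≐ t) (sym c″m≡tm) (update-self t m))))

  ∈X⇒raised : ∀ {c m c′ y} → PushAt m c′ → at c ≐ update t m c′ → InX lam c y →
    at y m ≤ L m × Admissible m (at y m) × y ≡ raised m (at y m)
  ∈X⇒raised {c} {m} {c′} {y} pu c≐update y∈X =
    bounded m<n , (positive m<n , y-free) , at-injective y (raised m (at y m)) (≐-trans y≐ (≐-sym (at-tabulateℕ n _)))
    where
    open PushAt pu
    y-pl = IsPlacement⇒Placement y (proj₁ y∈X)
    open Placement y-pl
    y≐ = pinned-push pu y-pl (InX⇒Pinned (FirstDifference-resp-≐ (≐-sym c≐update) m<n (push-first-difference pu)) y∈X)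
    y-free = ¬UsedBelow-agreeing y-pl (λ q<m → trans (y≐ _ (<-trans q<m m<n)) (update-≢ t _ (<⇒≢ q<m))) ≤-refl m<n

  push-chain : ∀ {c m c′} → PushAt m c′ → at c ≐ update t m c′ → IsChainOfLength (InX lam c) (L m ∸ suc m)
  push-chain {c} {m} pu c≐update = image-chain (raised m)
    (λ v≤w → ⊑⇒≼ (⊑-resp-≐ (≐-sym (at-tabulateℕ n _)) (≐-sym (at-tabulateℕ n _)) (update-mono t m v≤w)))
    raised-injective (Unique.filter⁺ (admissible? m) (Unique.downFrom⁺ (suc (L m)))) (count-admissible m<n)
    (λ v∈ → let (v∈range , admissible) = ∈-filter⁻ (admissible? m) v∈ in
      raised-∈X pu c≐update (≤-pred (∈-downFrom⁻ v∈range)) admissible)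
    (λ {y} y∈X → let (ym≤Lm , admissible , y≡) = ∈X⇒raised pu c≐update y∈X in
      at y m , ∈-filter⁺ (admissible? m) (∈-downFrom⁺ (s≤s ym≤Lm)) admissible , y≡)
    where
    m<n = PushAt.m<n pu
    raised-injective : ∀ {v w} → raised m v ≡ raised m w → v ≡ w
    raised-injective {v} {w} raised-v≡raised-w = begin
      v                  ≡⟨ update-≡ t m v ⟨
      update t m v m     ≡⟨ at-tabulateℕ n _ m m<n ⟨
      at (raised m v) m  ≡⟨ cong (λ x → at x m) raised-v≡raised-w ⟩
      at (raised m w) m  ≡⟨ at-tabulateℕ n _ m m<n ⟩
      update t m w m     ≡⟨ update-≡ t m w ⟩
      w                  ∎
      where open ≡-Reasoning

mainTheorem11 : ∀ (n : ℕ) (lam : Vec ℕ n) → IsPartition lam → RowBound lam →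
    ∀ (i : Fin n) → gjw lam i ≢ 0 → ∀ (c : Vec ℕ n) →
    (SwitchMove (top lam) i c → IsChainOfLength (InX lam c) 1)
    × (PushMove (top lam) i c → IsChainOfLength (InX lam c) (gjw lam i))
mainTheorem11 n lam part rb i _ c = switch-case , push-case
  where
  open Shape lam part rb
  switch-case : SwitchMove (top lam) i c → IsChainOfLength (InX lam c) 1
  switch-case move with switchMove⇒SwitchAt move
  ... | _ , sw , c≐swap = switch-chain sw c≐swap
  push-case : PushMove (top lam) i c → IsChainOfLength (InX lam c) (gjw lam i)
  push-case move with pushMove⇒PushAt move
  ... | _ , pu , c≐update = subst (IsChainOfLength (InX lam c)) (cong (_∸ suc (toℕ i)) (sym (lookup≡at lam i)))
          (push-chain pu c≐update)
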